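{- Let $k\ge 3$ and let $\vec s=(s_1,\dots,s_k)$ be positive integers. Let $B_{\vec s}$ be the subdivided banana graph: the graph with two distinguished vertices $a,b$ joined by $k$ internally vertex-disjoint paths of lengths $s_1,\dots,s_k$ (so the $l$-th path has $s_l-1$ internal vertices). Then $\mathcal S(B_{\vec s})\cong\mathcal S(C_{\vec s})$, where $C_{\vec s}$ is the thick $k$-cycle with multiplicity vector $\vec s$.
   Context: A thick $n$-cycle $C_{\vec a}$ with multiplicity vector $\vec a=(a_1,\dots,a_n)$ (positive integers) is the undirected multigraph on vertices $v_1,\dots,v_n$ in which $v_i$ and $v_{i+1}$ are joined by exactly $a_i$ parallel edges (indices modulo $n$), and there are no other edges. The Laplacian $L$ of an undirected multigraph on vertices $v_1,\dots,v_m$ has $L_{ii}=\deg(v_i)$ and $L_{ij}=-(\text{number of edges joining } v_i,v_j)$ for $i\ne j$. For a connected graph, the sandpile group $\mathcal S(G)$ is $\mathbb Z^{m-1}/\tilde\Delta\,\mathbb Z^{m-1}$, where $\tilde\Delta$ is the matrix obtained from $L$ by deleting the row and column of some vertex (the result is independent of the choice up to isomorphism). -}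

module Defs where

open import Data.Nat using (ℕ; zero; suc; _+_; _∸_; pred; _≡ᵇ_)
open import Data.Bool using (Bool; true; false; if_then_else_; _∧_; _∨_)
open import Data.Fin using (Fin; zero; suc; toℕ)
open import Data.Integer as ℤ using (ℤ; +_)
open import Data.List using (List; []; _∷_; _++_)
open import Data.Vec using (Vec; lookup; toList)
open import Data.Product using (_×_; _,_; ∃)
open import Relation.Binary.PropositionalEquality using (_≡_)

-- Undirected multigraphs on vertex set Fin m, given by their
-- edge-multiplicity function A i j = number of edges joining v_i, v_j.

Adj : ℕ → Set
Adj m = Fin m → Fin m → ℕ

Mat : ℕ → Set
Mat m = Fin m → Fin m → ℤ

ZVec : ℕ → Set
ZVec m = Fin m → ℤ

sumℕ : ∀ {n} → (Fin n → ℕ) → ℕ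
sumℕ {zero}  f = 0
sumℕ {suc n} f = f zero + sumℕ (λ i → f (suc i))

sumℤ : ∀ {n} → (Fin n → ℤ) → ℤ
sumℤ {zero}  f = + 0
sumℤ {suc n} f = f zero ℤ.+ sumℤ (λ i → f (suc i))

_==_ : ∀ {n} → Fin n → Fin n → Bool
i == j = toℕ i ≡ᵇ toℕ j

-- degree (loopless multigraphs: edges to all other vertices)
deg : ∀ {m} → Adj m → Fin m → ℕ
deg A i = sumℕ (λ j → if i == j then 0 else A i j)

laplacian : ∀ {m} → Adj m → Mat m
laplacian A i j = if i == j then + deg A i else ℤ.- (+ A i j)

reduced : ∀ {m} → Mat m → Mat (pred m)
reduced {suc m} L i j = L (suc i) (suc j)

_·_ : ∀ {n} → Mat n → ZVec n → ZVec n
(M · z) i = sumℤ (λ j → M i j ℤ.* z j)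

_⊕_ : ∀ {n} → ZVec n → ZVec n → ZVec n
(x ⊕ y) i = x i ℤ.+ y i

-- the congruence defining Z^n / Δ Z^n
_≈[_]_ : ∀ {n} → ZVec n → Mat n → ZVec n → Set
x ≈[ Δ ] y = ∃ λ z → ∀ i → x i ℤ.- y i ≡ (Δ · z) i

record CokerIso {m n : ℕ} (Δ : Mat m) (Δ' : Mat n) : Set where
  field
    to       : ZVec m → ZVec n
    from     : ZVec n → ZVec m
    to-cong  : ∀ {x y} → x ≈[ Δ ] y → to x ≈[ Δ' ] to y
    from-cong : ∀ {x y} → x ≈[ Δ' ] y → from x ≈[ Δ ] from y
    to-hom   : ∀ x y → to (x ⊕ y) ≈[ Δ' ] (to x ⊕ to y)
    to-from  : ∀ y → to (from y) ≈[ Δ' ] y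
    from-to  : ∀ x → from (to x) ≈[ Δ ] x

-- sandpile group S(G) = Z^{m-1} / Δ̃ Z^{m-1}; isomorphism of sandpile groups
_≅ₛ_ : ∀ {m n} → Adj m → Adj n → Set
G ≅ₛ H = CokerIso (reduced (laplacian G)) (reduced (laplacian H))

-- Thick k-cycle: v_i and v_{i+1} (indices mod k) joined by a_i edges.
-- With 0-based indices: vertex i is followed by i+1, and k-1 by 0.

isNext : ℕ → ℕ → ℕ → Bool
isNext k i j = (suc i ≡ᵇ j) ∨ ((j ≡ᵇ 0) ∧ (suc i ≡ᵇ k))

thickCycle : ∀ {k} → Vec ℕ k → Adj k
thickCycle {k} a i j =
  (if isNext k (toℕ i) (toℕ j) then lookup a i else 0)
  + (if isNext k (toℕ j) (toℕ i) then lookup a j else 0)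

countEdges : List (ℕ × ℕ) → ℕ → ℕ → ℕ
countEdges [] i j = 0
countEdges ((u , v) ∷ es) i j =
  (if ((u ≡ᵇ i) ∧ (v ≡ᵇ j)) ∨ ((u ≡ᵇ j) ∧ (v ≡ᵇ i)) then 1 else 0)
  + countEdges es i j

fromEdges : ∀ {m} → List (ℕ × ℕ) → Adj m
fromEdges es i j = countEdges es (toℕ i) (toℕ j)

-- path a - o - (o+1) - ... - (o+t) - b of length t+2, or edge a - b
chain : ℕ → ℕ → ℕ → List (ℕ × ℕ)
chain o zero    b = (o , b) ∷ []
chain o (suc t) b = (o , suc o) ∷ chain (suc o) t b

pathEdges : ℕ → ℕ → ℕ → ℕ → List (ℕ × ℕ)
pathEdges a b o zero          = []          -- excluded by positivity
pathEdges a b o (suc zero)    = (a , b) ∷ []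
pathEdges a b o (suc (suc t)) = (a , o) ∷ chain o t b

-- vertex 0 = a, vertex 1 = b, internal vertices numbered from 2 on,
-- path l using s_l - 1 consecutive fresh vertices
bananaEdges : ℕ → List ℕ → List (ℕ × ℕ)
bananaEdges o []       = []
bananaEdges o (s ∷ ss) = pathEdges 0 1 o s ++ bananaEdges (o + (s ∸ 1)) ss

internalCount : List ℕ → ℕ
internalCount []       = 0
internalCount (s ∷ ss) = (s ∸ 1) + internalCount ss

bananaSize : ∀ {k} → Vec ℕ k → ℕ
bananaSize s = 2 + internalCount (toList s)

banana : ∀ {k} → (s : Vec ℕ k) → Adj (bananaSize s)
banana s = fromEdges (bananaEdges 2 (toList s))

-- B_s is planar with dual C_s, and the isomorphism is given by explicit integer matrices
-- between the reduced Laplacians (a deleted from B_s, vertex 0 from C_s).  The vertex c + 1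
-- of C_s is dual to the face of B_s between paths c and c + 1; to it corresponds the
-- potential τ_c on B_s that vanishes at a and has slope +1 along path c and -1 along path
-- c + 1.  M evaluates these potentials at the vertices of B_s, and N sends the vertex c + 1
-- of C_s to the sum of the neighbours of a on the paths 0, …, c.  Pairing the Laplacian of
-- B_s with τ_c only sees the jumps of τ_c at b, which are Laplacian images in C_s; summation
-- by parts turns N of a Laplacian image of C_s into potentials on B_s; and both composites
-- NM and MN differ from the identity by such images.

module Submission where

open import Defs
open import Data.Nat using (ℕ; _≤_)
open import Data.Fin using (Fin)
open import Data.Vec using (Vec; lookup)

open import Data.Nat as ℕ using (zero; suc; _≡ᵇ_; _<ᵇ_; _≤ᵇ_; _∸_)
import Data.Nat.Properties as ℕP
open import Data.Integer using (ℤ; +_; _+_; _*_; -_; _-_; 0ℤ; 1ℤ)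
import Data.Integer.Properties as ℤP
open import Data.Integer.Tactic.RingSolver using (solve-∀)
open import Data.Fin using (zero; suc; toℕ; fromℕ<)
import Data.Fin.Properties as FP
open import Data.Bool using (Bool; true; false; if_then_else_; _∧_; _∨_; T)
open import Data.Unit using (tt)
open import Data.Product using (_×_; _,_; proj₁; proj₂)
open import Data.List using (List; []; _∷_; _++_; length)
open import Data.List.Relation.Unary.All using (All; []; _∷_)
import Data.List.Relation.Unary.All.Properties as AllP
open import Data.Vec as V using (toList)
import Data.Vec.Properties as VP
open import Relation.Binary.PropositionalEquality
open import Relation.Nullary using (yes; no; ¬_; Dec)
open import Data.Empty using (⊥-elim)
open import Function using (_∘_)

-- Finite sums

sumTo : ℕ → (ℕ → ℤ) → ℤ
sumTo zero    g = 0ℤ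
sumTo (suc m) g = g 0 + sumTo m (λ j → g (suc j))

syntax sumTo m (λ j → e) = ∑[ j < m ] e

∂ : (ℕ → ℤ) → ℕ → ℤ
∂ f j = f j - f (suc j)

sumℤ-sumTo : ∀ m (g : ℕ → ℤ) → sumℤ {m} (λ i → g (toℕ i)) ≡ sumTo m g
sumℤ-sumTo zero    g = refl
sumℤ-sumTo (suc m) g = cong (_+_ (g 0)) (sumℤ-sumTo m (λ j → g (suc j)))

sumTo-cong : ∀ m {f g : ℕ → ℤ} → (∀ j → f j ≡ g j) → sumTo m f ≡ sumTo m g
sumTo-cong zero    e = refl
sumTo-cong (suc m) e = cong₂ _+_ (e 0) (sumTo-cong m (λ j → e (suc j)))

sumTo-cong< : ∀ m {f g : ℕ → ℤ} → (∀ j → j ℕ.< m → f j ≡ g j) → sumTo m f ≡ sumTo m g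
sumTo-cong< zero    e = refl
sumTo-cong< (suc m) e = cong₂ _+_ (e 0 (ℕ.s≤s ℕ.z≤n)) (sumTo-cong< m (λ j p → e (suc j) (ℕ.s≤s p)))

interchange : ∀ a b c d → (a + b) + (c + d) ≡ (a + c) + (b + d)
interchange = solve-∀

sumTo-+ : ∀ m (f g : ℕ → ℤ) → ∑[ j < m ] (f j + g j) ≡ sumTo m f + sumTo m g
sumTo-+ zero    f g = refl
sumTo-+ (suc m) f g =
  trans (cong (_+_ (f 0 + g 0)) (sumTo-+ m _ _)) (interchange (f 0) (g 0) _ _)

sumTo-zero : ∀ m → ∑[ j < m ] 0ℤ ≡ 0ℤ
sumTo-zero zero    = refl
sumTo-zero (suc m) = trans (ℤP.+-identityˡ _) (sumTo-zero m)

sumTo-*ˡ : ∀ m c (f : ℕ → ℤ) → ∑[ j < m ] (c * f j) ≡ c * sumTo m f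
sumTo-*ˡ zero    c f = sym (ℤP.*-zeroʳ c)
sumTo-*ˡ (suc m) c f =
  trans (cong (_+_ (c * f 0)) (sumTo-*ˡ m c _)) (sym (ℤP.*-distribˡ-+ c (f 0) _))

sumTo-*ʳ : ∀ m c (f : ℕ → ℤ) → ∑[ j < m ] (f j * c) ≡ sumTo m f * c
sumTo-*ʳ m c f =
  trans (sumTo-cong m (λ j → ℤP.*-comm (f j) c)) (trans (sumTo-*ˡ m c f) (ℤP.*-comm c _))

sumTo-neg : ∀ m (f : ℕ → ℤ) → ∑[ j < m ] (- f j) ≡ - sumTo m f
sumTo-neg zero    f = refl
sumTo-neg (suc m) f =
  trans (cong (_+_ (- f 0)) (sumTo-neg m _)) (sym (ℤP.neg-distrib-+ (f 0) _))

sumTo-sub : ∀ m (f g : ℕ → ℤ) → ∑[ j < m ] (f j - g j) ≡ sumTo m f - sumTo m g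
sumTo-sub m f g = trans (sumTo-+ m f (λ j → - g j)) (cong (_+_ (sumTo m f)) (sumTo-neg m g))

sumTo-last : ∀ m (f : ℕ → ℤ) → sumTo (suc m) f ≡ sumTo m f + f m
sumTo-last zero    f = trans (ℤP.+-identityʳ (f 0)) (sym (ℤP.+-identityˡ (f 0)))
sumTo-last (suc m) f =
  trans (cong (_+_ (f 0)) (sumTo-last m (λ j → f (suc j)))) (sym (ℤP.+-assoc (f 0) _ _))

sumTo-tail : ∀ n (f : ℕ → ℤ) → f 0 ≡ 0ℤ → sumTo (suc n) f ≡ ∑[ v < n ] f (suc v)
sumTo-tail n f f0 = trans (cong (_+ ∑[ v < n ] f (suc v)) f0) (ℤP.+-identityˡ _)

sumTo-swap : ∀ m n (f : ℕ → ℕ → ℤ) →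
  ∑[ i < m ] ∑[ j < n ] f i j ≡ ∑[ j < n ] ∑[ i < m ] f i j
sumTo-swap zero    n f = sym (sumTo-zero n)
sumTo-swap (suc m) n f =
  trans (cong (_+_ (sumTo n (f 0))) (sumTo-swap m n (λ i j → f (suc i) j)))
        (sym (sumTo-+ n (f 0) (λ j → ∑[ i < m ] f (suc i) j)))

sumTo-telescope : ∀ m (w : ℕ → ℤ) → ∑[ i < m ] ∂ w i ≡ w 0 - w m
sumTo-telescope zero    w = sym (ℤP.+-inverseʳ (w 0))
sumTo-telescope (suc m) w =
  trans (cong (_+_ (w 0 - w 1)) (sumTo-telescope m (λ i → w (suc i)))) (cancel (w 0) (w 1) (w (suc m)))
  where
  cancel : ∀ a b c → (a - b) + (b - c) ≡ a - c
  cancel = solve-∀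

sumTo-telescope′ : ∀ m (w : ℕ → ℤ) → ∑[ i < m ] (w (suc i) - w i) ≡ w m - w 0
sumTo-telescope′ m w = begin
  ∑[ i < m ] (w (suc i) - w i)    ≡⟨ sumTo-cong m (λ i → flip (w i) (w (suc i))) ⟩
  ∑[ i < m ] (- (w i - w (suc i))) ≡⟨ sumTo-neg m (λ i → w i - w (suc i)) ⟩
  - ∑[ i < m ] (w i - w (suc i))   ≡⟨ cong -_ (sumTo-telescope m w) ⟩
  - (w 0 - w m)                    ≡⟨ flip (w 0) (w m) ⟨
  w m - w 0                        ∎
  where
  open ≡-Reasoning
  flip : ∀ a b → b - a ≡ - (a - b)
  flip = solve-∀

sumTo-byParts : ∀ m (D φ : ℕ → ℤ) →
  ∑[ c < m ] ((D c - D (suc c)) * φ (suc c))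
    ≡ ∑[ c < m ] (D c * (φ (suc c) - φ c)) - D m * φ m + D 0 * φ 0
sumTo-byParts zero D φ = sym (cancel (D 0 * φ 0))
  where
  cancel : ∀ a → 0ℤ - a + a ≡ 0ℤ
  cancel = solve-∀
sumTo-byParts (suc m) D φ = begin
  ∑[ c < suc m ] ((D c - D (suc c)) * φ (suc c))
    ≡⟨ sumTo-last m (λ c → (D c - D (suc c)) * φ (suc c)) ⟩
  ∑[ c < m ] ((D c - D (suc c)) * φ (suc c)) + (D m - D (suc m)) * φ (suc m)
    ≡⟨ cong (_+ (D m - D (suc m)) * φ (suc m)) (sumTo-byParts m D φ) ⟩
  Σ - D m * φ m + D 0 * φ 0 + (D m - D (suc m)) * φ (suc m)
    ≡⟨ regroup Σ (D m) (D (suc m)) (φ m) (φ (suc m)) (D 0 * φ 0) ⟩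
  Σ + D m * (φ (suc m) - φ m) - D (suc m) * φ (suc m) + D 0 * φ 0
    ≡⟨ cong (λ t → t - D (suc m) * φ (suc m) + D 0 * φ 0) (sym (sumTo-last m (λ c → D c * (φ (suc c) - φ c)))) ⟩
  ∑[ c < suc m ] (D c * (φ (suc c) - φ c)) - D (suc m) * φ (suc m) + D 0 * φ 0
    ∎
  where
  open ≡-Reasoning
  Σ = ∑[ c < m ] (D c * (φ (suc c) - φ c))
  regroup : ∀ s dm dm1 pm pm1 z →
    s - dm * pm + z + (dm - dm1) * pm1 ≡ s + dm * (pm1 - pm) - dm1 * pm1 + z
  regroup = solve-∀

sumTo-*-rampStep : ∀ m J (X : ℕ → ℤ) → J ℕ.≤ m →
  ∑[ j < m ] (X j * (+ (J ∸ j) - + (J ∸ suc j))) ≡ sumTo J X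
sumTo-*-rampStep m zero X _ =
  trans (sumTo-cong m (λ j → trans (cong₂ (λ a b → X j * (+ a - + b)) (ℕP.0∸n≡0 j) (ℕP.0∸n≡0 (suc j)))
                                   (ℤP.*-zeroʳ (X j))))
        (sumTo-zero m)
sumTo-*-rampStep (suc m) (suc J) X (ℕ.s≤s J≤m) =
  cong₂ _+_ (trans (cong (λ t → X 0 * (t - + J)) (ℤP.pos-+ 1 J)) (unitStep (X 0) (+ J)))
            (sumTo-*-rampStep m J (λ j → X (suc j)) J≤m)
  where
  unitStep : ∀ x y → x * (1ℤ + y - y) ≡ x
  unitStep = solve-∀

δ : ℕ → ℕ → ℤ
δ u j = if u ≡ᵇ j then 1ℤ else 0ℤ

δᶜ : ℕ → ℕ → ℤ
δᶜ u j = if u ≡ᵇ j then 0ℤ else 1ℤ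

δ-refl : ∀ a → δ a a ≡ 1ℤ
δ-refl zero    = refl
δ-refl (suc a) = δ-refl a

δ-≢ : ∀ {a b} → a ≢ b → δ a b ≡ 0ℤ
δ-≢ {zero}  {zero}  p = ⊥-elim (p refl)
δ-≢ {zero}  {suc b} p = refl
δ-≢ {suc a} {zero}  p = refl
δ-≢ {suc a} {suc b} p = δ-≢ {a} {b} (λ e → p (cong suc e))

δᶜ-≢ : ∀ {a b} → a ≢ b → δᶜ a b ≡ 1ℤ
δᶜ-≢ {zero}  {zero}  p = ⊥-elim (p refl)
δᶜ-≢ {zero}  {suc b} p = refl
δᶜ-≢ {suc a} {zero}  p = refl
δᶜ-≢ {suc a} {suc b} p = δᶜ-≢ {a} {b} (λ e → p (cong suc e))

δ-sym : ∀ a b → δ a b ≡ δ b a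
δ-sym zero    zero    = refl
δ-sym zero    (suc b) = refl
δ-sym (suc a) zero    = refl
δ-sym (suc a) (suc b) = δ-sym a b

δ-*-subst : ∀ (f : ℕ → ℤ) a b → δ a b * f a ≡ δ a b * f b
δ-*-subst f a b with a ℕ.≟ b
... | yes refl = refl
... | no a≢b rewrite δ-≢ a≢b = trans (ℤP.*-zeroˡ (f a)) (sym (ℤP.*-zeroˡ (f b)))

sumTo-δ : ∀ m u (f : ℕ → ℤ) → u ℕ.< m → ∑[ j < m ] (δ u j * f j) ≡ f u
sumTo-δ (suc m) zero f _ = begin
  1ℤ * f 0 + ∑[ j < m ] (0ℤ * f (suc j)) ≡⟨ cong (_+_ (1ℤ * f 0)) (sumTo-cong m (ℤP.*-zeroˡ ∘ f ∘ suc)) ⟩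
  1ℤ * f 0 + ∑[ j < m ] 0ℤ               ≡⟨ cong (_+_ (1ℤ * f 0)) (sumTo-zero m) ⟩
  1ℤ * f 0 + 0ℤ                          ≡⟨ ℤP.+-identityʳ _ ⟩
  1ℤ * f 0                               ≡⟨ ℤP.*-identityˡ (f 0) ⟩
  f 0                                    ∎
  where open ≡-Reasoning
sumTo-δ (suc m) (suc u) f (ℕ.s≤s u<m) = trans (ℤP.+-identityˡ _) (sumTo-δ m u (λ j → f (suc j)) u<m)

sumTo-δ-beyond : ∀ m u (f : ℕ → ℤ) → m ℕ.≤ u → ∑[ j < m ] (δ u j * f j) ≡ 0ℤ
sumTo-δ-beyond zero    u       f _           = refl
sumTo-δ-beyond (suc m) (suc u) f (ℕ.s≤s m≤u) = trans (ℤP.+-identityˡ _) (sumTo-δ-beyond m u (λ j → f (suc j)) m≤u)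

sumTo-δ-const : ∀ m u → u ℕ.< m → ∑[ j < m ] δ j u ≡ 1ℤ
sumTo-δ-const m u u<m =
  trans (sumTo-cong m (λ j → trans (δ-sym j u) (sym (ℤP.*-identityʳ (δ u j))))) (sumTo-δ m u (λ _ → 1ℤ) u<m)

sumTo-δ-suc : ∀ n x (τ : ℕ → ℤ) → τ 0 ≡ 0ℤ → x ℕ.< suc n →
  ∑[ v < n ] (δ (suc v) x * τ (suc v)) ≡ τ x
sumTo-δ-suc n x τ τ0 x≤n = begin
  ∑[ v < n ] (δ (suc v) x * τ (suc v)) ≡⟨ sumTo-tail n (λ v → δ v x * τ v) δτ0 ⟨
  ∑[ v < suc n ] (δ v x * τ v)         ≡⟨ sumTo-cong (suc n) (λ v → cong (_* τ v) (δ-sym v x)) ⟩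
  ∑[ v < suc n ] (δ x v * τ v)         ≡⟨ sumTo-δ (suc n) x τ x≤n ⟩
  τ x                                  ∎
  where
  open ≡-Reasoning
  δτ0 : δ 0 x * τ 0 ≡ 0ℤ
  δτ0 = trans (cong (δ 0 x *_) τ0) (ℤP.*-zeroʳ (δ 0 x))

sumList : ∀ {A : Set} → List A → (A → ℤ) → ℤ
sumList []       f = 0ℤ
sumList (x ∷ xs) f = f x + sumList xs f

sumList-++ : ∀ {A : Set} (xs ys : List A) f → sumList (xs ++ ys) f ≡ sumList xs f + sumList ys f
sumList-++ []       ys f = sym (ℤP.+-identityˡ _)
sumList-++ (x ∷ xs) ys f = trans (cong (_+_ (f x)) (sumList-++ xs ys f)) (sym (ℤP.+-assoc (f x) _ _))

sumList-congAll : ∀ {A : Set} {P : A → Set} (xs : List A) → All P xs → {f g : A → ℤ} →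
  (∀ a → P a → f a ≡ g a) → sumList xs f ≡ sumList xs g
sumList-congAll []       []       e = refl
sumList-congAll (x ∷ xs) (p ∷ ps) e = cong₂ _+_ (e x p) (sumList-congAll xs ps e)

sumList-*ʳ : ∀ {A : Set} (xs : List A) c (f : A → ℤ) → sumList xs f * c ≡ sumList xs (λ a → f a * c)
sumList-*ʳ []       c f = ℤP.*-zeroˡ c
sumList-*ʳ (x ∷ xs) c f = trans (ℤP.*-distribʳ-+ c (f x) _) (cong (_+_ (f x * c)) (sumList-*ʳ xs c f))

sumTo-sumList : ∀ {A : Set} m (xs : List A) (f : ℕ → A → ℤ) →
  ∑[ i < m ] sumList xs (f i) ≡ sumList xs (λ a → ∑[ i < m ] f i a)
sumTo-sumList m []       f = sumTo-zero m
sumTo-sumList m (x ∷ xs) f =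
  trans (sumTo-+ m (λ i → f i x) (λ i → sumList xs (f i)))
        (cong (_+_ (∑[ i < m ] f i x)) (sumTo-sumList m xs f))

-- Cokernels of integer matrices

sumℤ-cong : ∀ {m} {f g : Fin m → ℤ} → (∀ i → f i ≡ g i) → sumℤ f ≡ sumℤ g
sumℤ-cong {zero}  e = refl
sumℤ-cong {suc m} e = cong₂ _+_ (e zero) (sumℤ-cong (λ i → e (suc i)))

sumℤ-+ : ∀ {m} (f g : Fin m → ℤ) → sumℤ (λ j → f j + g j) ≡ sumℤ f + sumℤ g
sumℤ-+ {zero}  f g = refl
sumℤ-+ {suc m} f g =
  trans (cong (_+_ (f zero + g zero)) (sumℤ-+ (λ j → f (suc j)) (λ j → g (suc j))))
        (interchange (f zero) (g zero) _ _)

sumℤ-*ˡ : ∀ {m} c (f : Fin m → ℤ) → sumℤ (λ j → c * f j) ≡ c * sumℤ f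
sumℤ-*ˡ {zero}  c f = sym (ℤP.*-zeroʳ c)
sumℤ-*ˡ {suc m} c f =
  trans (cong (_+_ (c * f zero)) (sumℤ-*ˡ c (λ j → f (suc j)))) (sym (ℤP.*-distribˡ-+ c (f zero) _))

sumℤ-zero : ∀ m → sumℤ {m} (λ _ → 0ℤ) ≡ 0ℤ
sumℤ-zero zero    = refl
sumℤ-zero (suc m) = trans (ℤP.+-identityˡ _) (sumℤ-zero m)

sumℤ-neg : ∀ {m} (f : Fin m → ℤ) → sumℤ (λ j → - f j) ≡ - sumℤ f
sumℤ-neg {zero}  f = refl
sumℤ-neg {suc m} f =
  trans (cong (_+_ (- f zero)) (sumℤ-neg (λ j → f (suc j)))) (sym (ℤP.neg-distrib-+ (f zero) _))

sumℤ-sub : ∀ {m} (f g : Fin m → ℤ) → sumℤ (λ j → f j - g j) ≡ sumℤ f - sumℤ g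
sumℤ-sub f g = trans (sumℤ-+ f (λ j → - g j)) (cong (_+_ (sumℤ f)) (sumℤ-neg g))

sumℤ-swap : ∀ {m n} (f : Fin m → Fin n → ℤ) →
  sumℤ (λ i → sumℤ (λ j → f i j)) ≡ sumℤ (λ j → sumℤ (λ i → f i j))
sumℤ-swap {zero}  {n} f = sym (sumℤ-zero n)
sumℤ-swap {suc m} {n} f =
  trans (cong (_+_ (sumℤ (f zero))) (sumℤ-swap (λ i j → f (suc i) j)))
        (sym (sumℤ-+ (f zero) (λ j → sumℤ (λ i → f (suc i) j))))

δᶠ : ∀ {m} → Fin m → Fin m → ℤ
δᶠ a b = if a == b then 1ℤ else 0ℤ

sumℤ-δᶠ : ∀ {m} (y : Fin m → ℤ) (c : Fin m) → sumℤ (λ a → y a * δᶠ a c) ≡ y c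
sumℤ-δᶠ {suc m} y zero =
  trans (cong₂ _+_ (ℤP.*-identityʳ (y zero))
                   (trans (sumℤ-cong (λ a → ℤP.*-zeroʳ (y (suc a)))) (sumℤ-zero m)))
        (ℤP.+-identityʳ _)
sumℤ-δᶠ {suc m} y (suc c) =
  trans (cong₂ _+_ (ℤP.*-zeroʳ (y zero)) (sumℤ-δᶠ (λ a → y (suc a)) c)) (ℤP.+-identityˡ _)

*-distribˡ-sub : ∀ a b c → a * (b - c) ≡ a * b - a * c
*-distribˡ-sub = solve-∀

*-distribʳ-sub : ∀ a b c → (a - b) * c ≡ a * c - b * c
*-distribʳ-sub = solve-∀

infixl 7 _⋆_
infix  4 _∈Im_

_⋆_ : ∀ {m n} → ZVec m → (Fin m → Fin n → ℤ) → ZVec n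
(x ⋆ M) c = sumℤ (λ i → x i * M i c)

record _∈Im_ {n} (y : ZVec n) (Δ : Mat n) : Set where
  constructor image
  field
    preimage : ZVec n
    image-eq : ∀ i → y i ≡ (Δ · preimage) i

∈Im-cong : ∀ {n} {Δ : Mat n} {y y′ : ZVec n} → (∀ i → y i ≡ y′ i) → y ∈Im Δ → y′ ∈Im Δ
∈Im-cong y≡y′ (image z eq) = image z (λ i → trans (sym (y≡y′ i)) (eq i))

∈Im-0 : ∀ {n} {Δ : Mat n} → (λ _ → 0ℤ) ∈Im Δ
∈Im-0 {n} {Δ} = image (λ _ → 0ℤ) (λ i → sym (trans (sumℤ-cong (λ j → ℤP.*-zeroʳ (Δ i j))) (sumℤ-zero n)))

∈Im-+ : ∀ {n} {Δ : Mat n} {y y′ : ZVec n} → y ∈Im Δ → y′ ∈Im Δ → (λ i → y i + y′ i) ∈Im Δ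
∈Im-+ {Δ = Δ} (image z eq) (image z′ eq′) = image (λ j → z j + z′ j) λ i →
  trans (cong₂ _+_ (eq i) (eq′ i))
        (trans (sym (sumℤ-+ (λ j → Δ i j * z j) (λ j → Δ i j * z′ j)))
               (sumℤ-cong (λ j → sym (ℤP.*-distribˡ-+ (Δ i j) (z j) (z′ j)))))

∈Im-* : ∀ {n} {Δ : Mat n} {y : ZVec n} c → y ∈Im Δ → (λ i → c * y i) ∈Im Δ
∈Im-* {Δ = Δ} c (image z eq) = image (λ j → c * z j) λ i →
  trans (cong (c *_) (eq i)) (trans (sym (sumℤ-*ˡ c (λ j → Δ i j * z j))) (sumℤ-cong (λ j → swap c (Δ i j) (z j))))
  where
  swap : ∀ a b d → a * (b * d) ≡ b * (a * d)
  swap = solve-∀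

∈Im-neg : ∀ {n} {Δ : Mat n} {y : ZVec n} → y ∈Im Δ → (λ i → - y i) ∈Im Δ
∈Im-neg {y = y} y∈ = ∈Im-cong (λ i → ℤP.-1*i≡-i (y i)) (∈Im-* (- 1ℤ) y∈)

∈Im-⋆ : ∀ {n m} {Δ : Mat n} (x : ZVec m) (V : Fin m → ZVec n) → (∀ a → V a ∈Im Δ) → x ⋆ V ∈Im Δ
∈Im-⋆ {m = zero}  x V V∈ = ∈Im-0
∈Im-⋆ {m = suc m} x V V∈ =
  ∈Im-+ (∈Im-* (x zero) (V∈ zero)) (∈Im-⋆ (λ a → x (suc a)) (λ a → V (suc a)) (λ a → V∈ (suc a)))

∈Im-sumTo : ∀ {n} {Δ : Mat n} m (x : ℕ → ℤ) (V : ℕ → ZVec n) → (∀ l → l ℕ.< m → V l ∈Im Δ) →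
  (λ i → ∑[ l < m ] (x l * V l i)) ∈Im Δ
∈Im-sumTo zero    x V V∈ = ∈Im-0
∈Im-sumTo (suc m) x V V∈ =
  ∈Im-+ (∈Im-* (x 0) (V∈ 0 (ℕ.s≤s ℕ.z≤n)))
        (∈Im-sumTo m (λ l → x (suc l)) (λ l → V (suc l)) (λ l p → V∈ (suc l) (ℕ.s≤s p)))

⋆-sub : ∀ {m n} (x y : ZVec m) (M : Fin m → Fin n → ℤ) c →
  (x ⋆ M) c - (y ⋆ M) c ≡ ((λ i → x i - y i) ⋆ M) c
⋆-sub x y M c =
  trans (sym (sumℤ-sub (λ i → x i * M i c) (λ i → y i * M i c)))
        (sumℤ-cong (λ i → sym (*-distribʳ-sub (x i) (y i) (M i c))))

⋆-assoc : ∀ {k l p} (y : ZVec k) (P : Fin k → Fin l → ℤ) (Q : Fin l → Fin p → ℤ) c →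
  (y ⋆ P ⋆ Q) c ≡ (y ⋆ (λ a → P a ⋆ Q)) c
⋆-assoc y P Q c =
  trans (sumℤ-cong (λ i → trans (ℤP.*-comm _ (Q i c))
                         (trans (sym (sumℤ-*ˡ (Q i c) (λ a → y a * P a i)))
                                (sumℤ-cong (λ a → rearrange (Q i c) (y a) (P a i))))))
        (trans (sumℤ-swap (λ i a → y a * (P a i * Q i c)))
               (sumℤ-cong (λ a → sumℤ-*ˡ (y a) (λ i → P a i * Q i c))))
  where
  rearrange : ∀ q y p → q * (y * p) ≡ y * (p * q)
  rearrange = solve-∀

⋆-inverse : ∀ {m n} {Δ : Mat m} (P : Fin m → Fin n → ℤ) (Q : Fin n → Fin m → ℤ) →
  (∀ i → (λ i′ → (P i ⋆ Q) i′ - δᶠ i i′) ∈Im Δ) → ∀ x → (λ i → (x ⋆ P ⋆ Q) i - x i) ∈Im Δ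
⋆-inverse P Q PQ≈I x = ∈Im-cong regroup (∈Im-⋆ x (λ i i′ → (P i ⋆ Q) i′ - δᶠ i i′) PQ≈I)
  where
  regroup : ∀ c → (x ⋆ (λ i i′ → (P i ⋆ Q) i′ - δᶠ i i′)) c ≡ (x ⋆ P ⋆ Q) c - x c
  regroup c =
    trans (sumℤ-cong (λ a → *-distribˡ-sub (x a) ((P a ⋆ Q) c) (δᶠ a c)))
          (trans (sumℤ-sub (λ a → x a * (P a ⋆ Q) c) (λ a → x a * δᶠ a c))
                 (cong₂ _-_ (sym (⋆-assoc x P Q c)) (sumℤ-δᶠ x c)))

cokerIso : ∀ {m n} {Δ : Mat m} {Δ′ : Mat n} (M : Fin m → Fin n → ℤ) (N : Fin n → Fin m → ℤ) →
  (∀ z → (Δ · z) ⋆ M ∈Im Δ′) → (∀ z → (Δ′ · z) ⋆ N ∈Im Δ) →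
  (∀ c → (λ c′ → (N c ⋆ M) c′ - δᶠ c c′) ∈Im Δ′) →
  (∀ i → (λ i′ → (M i ⋆ N) i′ - δᶠ i i′) ∈Im Δ) →
  CokerIso Δ Δ′
cokerIso {Δ = Δ} {Δ′} M N ΔM⊆ Δ′N⊆ NM≈I MN≈I = record
  { to        = _⋆ M
  ; from      = _⋆ N
  ; to-cong   = λ {x} {y} → map {Δ₁ = Δ} M ΔM⊆ x y
  ; from-cong = λ {x} {y} → map {Δ₁ = Δ′} N Δ′N⊆ x y
  ; to-hom    = λ x y → toCongr {Δ″ = Δ′} ((λ i → x i + y i) ⋆ M) ((x ⋆ M) ⊕ (y ⋆ M))
                                  (∈Im-cong (λ c → sym (additive x y c)) ∈Im-0)
  ; to-from   = λ y → toCongr (y ⋆ N ⋆ M) y (⋆-inverse N M NM≈I y)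
  ; from-to   = λ x → toCongr (x ⋆ M ⋆ N) x (⋆-inverse M N MN≈I x)
  }
  where
  toCongr : ∀ {p} {Δ″ : Mat p} (x y : ZVec p) → (λ i → x i - y i) ∈Im Δ″ → x ≈[ Δ″ ] y
  toCongr x y (image z eq) = z , eq
  map : ∀ {p q} {Δ₁ : Mat p} {Δ₂ : Mat q} (P : Fin p → Fin q → ℤ) →
    (∀ z → (Δ₁ · z) ⋆ P ∈Im Δ₂) → ∀ x y → x ≈[ Δ₁ ] y → (x ⋆ P) ≈[ Δ₂ ] (y ⋆ P)
  map P ΔP⊆ x y (z , eq) =
    toCongr (x ⋆ P) (y ⋆ P)
            (∈Im-cong (λ c → trans (sumℤ-cong (λ i → cong (_* P i c) (sym (eq i)))) (sym (⋆-sub x y P c)))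
                      (ΔP⊆ z))
  additive : ∀ x y c → (((λ i → x i + y i) ⋆ M) c - ((x ⋆ M) ⊕ (y ⋆ M)) c) ≡ 0ℤ
  additive x y c =
    trans (cong (_-_ (((λ i → x i + y i) ⋆ M) c))
                (sym (trans (sumℤ-cong (λ i → ℤP.*-distribʳ-+ (M i c) (x i) (y i)))
                            (sumℤ-+ (λ i → x i * M i c) (λ i → y i * M i c)))))
          (ℤP.+-inverseʳ (((λ i → x i + y i) ⋆ M) c))

-- Laplacians of multigraphs

-- zero from n on
atℕ : ∀ {n} → ZVec n → ℕ → ℤ
atℕ {zero}  z _       = 0ℤ
atℕ {suc n} z zero    = z zero
atℕ {suc n} z (suc j) = atℕ (λ i → z (suc i)) j

atℕ-toℕ : ∀ {n} (z : ZVec n) i → atℕ z (toℕ i) ≡ z i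
atℕ-toℕ z zero    = refl
atℕ-toℕ z (suc i) = atℕ-toℕ (λ i → z (suc i)) i

atℕ-beyond : ∀ {n} (z : ZVec n) → atℕ z n ≡ 0ℤ
atℕ-beyond {zero}  z = refl
atℕ-beyond {suc n} z = atℕ-beyond (λ i → z (suc i))

atℕ-tabulate : ∀ {n} (f : ℕ → ℤ) j → j ℕ.< n → atℕ {n} (λ c → f (toℕ c)) j ≡ f j
atℕ-tabulate {suc n} f zero    _         = refl
atℕ-tabulate {suc n} f (suc j) (ℕ.s≤s p) = atℕ-tabulate {n} (λ x → f (suc x)) j p

-- reduced coordinates shifted to the vertices 1, 2, …, with the deleted vertex 0 getting value 0
extend : ∀ {n} → ZVec n → ℕ → ℤ
extend z zero    = 0ℤ
extend z (suc j) = atℕ z j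

extend-tabulate : ∀ {n} (f : ℕ → ℤ) → f 0 ≡ 0ℤ → ∀ v → v ℕ.< suc n →
  extend {n} (λ i → f (suc (toℕ i))) v ≡ f v
extend-tabulate f f0 zero    _         = sym f0
extend-tabulate f f0 (suc v) (ℕ.s≤s p) = atℕ-tabulate (λ x → f (suc x)) v p

pos-sumℕ : ∀ {m} (f : Fin m → ℕ) → + sumℕ f ≡ sumℤ (λ j → + f j)
pos-sumℕ {zero}  f = refl
pos-sumℕ {suc m} f = trans (ℤP.pos-+ (f zero) _) (cong (_+_ (+ f zero)) (pos-sumℕ (λ j → f (suc j))))

module _ {n} (A : Adj (suc n)) (Aℕ : ℕ → ℕ → ℕ) (A≡Aℕ : ∀ i j → A i j ≡ Aℕ (toℕ i) (toℕ j)) where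

  pos-deg : ∀ i → + deg A i ≡ ∑[ v < suc n ] (δᶜ (toℕ i) v * + Aℕ (toℕ i) v)
  pos-deg i =
    trans (pos-sumℕ (λ j → if i == j then 0 else A i j))
          (trans (sumℤ-cong entry) (sumℤ-sumTo (suc n) (λ v → δᶜ (toℕ i) v * + Aℕ (toℕ i) v)))
    where
    entry : ∀ j → + (if i == j then 0 else A i j) ≡ δᶜ (toℕ i) (toℕ j) * + Aℕ (toℕ i) (toℕ j)
    entry j with i == j
    ... | true  = sym (ℤP.*-zeroˡ (+ Aℕ (toℕ i) (toℕ j)))
    ... | false = trans (cong +_ (A≡Aℕ i j)) (sym (ℤP.*-identityˡ _))

  laplacian-entry : ∀ i j →
    laplacian A i j ≡ δ (toℕ i) (toℕ j) * + deg A i - δᶜ (toℕ i) (toℕ j) * + Aℕ (toℕ i) (toℕ j)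
  laplacian-entry i j with i == j
  ... | true  = onDiagonal (+ deg A i) (+ Aℕ (toℕ i) (toℕ j))
    where
    onDiagonal : ∀ d a → d ≡ 1ℤ * d - 0ℤ * a
    onDiagonal = solve-∀
  ... | false = trans (cong (λ a → - + a) (A≡Aℕ i j)) (offDiagonal (+ deg A i) (+ Aℕ (toℕ i) (toℕ j)))
    where
    offDiagonal : ∀ d a → - a ≡ 0ℤ * d - 1ℤ * a
    offDiagonal = solve-∀

  reducedLaplacian-· : ∀ (z : ZVec n) (i : Fin n) →
    (reduced (laplacian A) · z) i
      ≡ ∑[ v < suc n ] (δᶜ (suc (toℕ i)) v * + Aℕ (suc (toℕ i)) v * (extend z (suc (toℕ i)) - extend z v))
  reducedLaplacian-· z i = begin
    sumℤ (λ j → laplacian A (suc i) (suc j) * z j)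
      ≡⟨ sumℤ-cong entry ⟩
    sumℤ {n} (λ j → g (toℕ j))
      ≡⟨ sumℤ-sumTo n g ⟩
    ∑[ v < n ] (δ u (suc v) * (D * Z (suc v)) - Ā (suc v) * Z (suc v))
      ≡⟨ sumTo-sub n (λ v → δ u (suc v) * (D * Z (suc v))) (λ v → Ā (suc v) * Z (suc v)) ⟩
    ∑[ v < n ] (δ u (suc v) * (D * Z (suc v))) - ∑[ v < n ] (Ā (suc v) * Z (suc v))
      ≡⟨ cong₂ _-_ diagonal (sym (sumTo-tail n (λ v → Ā v * Z v) (ℤP.*-zeroʳ (Ā 0)))) ⟩
    D * Z u - ∑[ v < suc n ] (Ā v * Z v)
      ≡⟨ cong (λ t → t * Z u - ∑[ v < suc n ] (Ā v * Z v)) (pos-deg (suc i)) ⟩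
    sumTo (suc n) Ā * Z u - ∑[ v < suc n ] (Ā v * Z v)
      ≡⟨ cong (_- ∑[ v < suc n ] (Ā v * Z v)) (sym (sumTo-*ʳ (suc n) (Z u) Ā)) ⟩
    ∑[ v < suc n ] (Ā v * Z u) - ∑[ v < suc n ] (Ā v * Z v)
      ≡⟨ sym (sumTo-sub (suc n) (λ v → Ā v * Z u) (λ v → Ā v * Z v)) ⟩
    ∑[ v < suc n ] (Ā v * Z u - Ā v * Z v)
      ≡⟨ sumTo-cong (suc n) (λ v → sym (*-distribˡ-sub (Ā v) (Z u) (Z v))) ⟩
    ∑[ v < suc n ] (Ā v * (Z u - Z v))
      ∎
    where
    open ≡-Reasoning
    u = suc (toℕ i)
    Z = extend z
    D = + deg A (suc i)
    Ā : ℕ → ℤ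
    Ā v = δᶜ u v * + Aℕ u v
    g : ℕ → ℤ
    g v = δ u (suc v) * (D * Z (suc v)) - Ā (suc v) * Z (suc v)
    distrib : ∀ d e a x → (d * e - a) * x ≡ d * (e * x) - a * x
    distrib = solve-∀
    entry : ∀ j → laplacian A (suc i) (suc j) * z j ≡ g (toℕ j)
    entry j = trans (cong₂ _*_ (laplacian-entry (suc i) (suc j)) (sym (atℕ-toℕ z j)))
                    (distrib (δ u (suc (toℕ j))) D (Ā (suc (toℕ j))) (Z (suc (toℕ j))))
    diagonal : ∑[ v < n ] (δ u (suc v) * (D * Z (suc v))) ≡ D * Z u
    diagonal =
      trans (sym (sumTo-tail n (λ v → δ u v * (D * Z v)) (ℤP.*-zeroˡ (D * Z 0))))
            (sumTo-δ (suc n) u (λ v → D * Z v) (ℕ.s≤s (FP.toℕ<n i)))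

boolℤ : Bool → ℤ
boolℤ b = if b then 1ℤ else 0ℤ

boolℤ-∨-∧ : ∀ a b c d → a ∧ d ≡ false →
  + (if (a ∧ b) ∨ (c ∧ d) then 1 else 0) ≡ boolℤ a * boolℤ b + boolℤ c * boolℤ d
boolℤ-∨-∧ true  true  true  true  ()
boolℤ-∨-∧ true  true  true  false _ = refl
boolℤ-∨-∧ true  true  false true  ()
boolℤ-∨-∧ true  true  false false _ = refl
boolℤ-∨-∧ true  false true  true  ()
boolℤ-∨-∧ true  false true  false _ = refl
boolℤ-∨-∧ true  false false true  ()
boolℤ-∨-∧ true  false false false _ = refl
boolℤ-∨-∧ false true  true  true  _ = refl
boolℤ-∨-∧ false true  true  false _ = refl
boolℤ-∨-∧ false true  false true  _ = refl
boolℤ-∨-∧ false true  false false _ = refl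
boolℤ-∨-∧ false false true  true  _ = refl
boolℤ-∨-∧ false false true  false _ = refl
boolℤ-∨-∧ false false false true  _ = refl
boolℤ-∨-∧ false false false false _ = refl

≢⇒¬both-≡ᵇ : ∀ {x y} u → x ≢ y → (x ≡ᵇ u) ∧ (y ≡ᵇ u) ≡ false
≢⇒¬both-≡ᵇ {zero}  {zero}  zero    p = ⊥-elim (p refl)
≢⇒¬both-≡ᵇ {zero}  {suc y} zero    p = refl
≢⇒¬both-≡ᵇ {suc x} {y}     zero    p = refl
≢⇒¬both-≡ᵇ {zero}  {y}     (suc u) p = refl
≢⇒¬both-≡ᵇ {suc x} {zero}  (suc u) p with x ≡ᵇ u
... | true  = refl
... | false = refl
≢⇒¬both-≡ᵇ {suc x} {suc y} (suc u) p = ≢⇒¬both-≡ᵇ {x} {y} u (λ e → p (cong suc e))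

∂ₑ : (ℕ → ℤ) → ℕ × ℕ → ℤ
∂ₑ f e = f (proj₁ e) - f (proj₂ e)

ProperEdge : ℕ → ℕ × ℕ → Set
ProperEdge m (x , y) = (x ≢ y) × (x ℕ.< m) × (y ℕ.< m)

pos-countEdges-∷ : ∀ x y es u j → x ≢ y →
  + countEdges ((x , y) ∷ es) u j ≡ (δ x u * δ y j + δ x j * δ y u) + + countEdges es u j
pos-countEdges-∷ x y es u j x≢y =
  trans (ℤP.pos-+ _ (countEdges es u j))
        (cong (_+ + countEdges es u j)
              (boolℤ-∨-∧ (x ≡ᵇ u) (y ≡ᵇ j) (x ≡ᵇ j) (y ≡ᵇ u) (≢⇒¬both-≡ᵇ u x≢y)))

sumTo-singleEdge : ∀ m x y u (Z : ℕ → ℤ) → ProperEdge m (x , y) →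
  ∑[ j < m ] (δᶜ u j * (δ x u * δ y j + δ x j * δ y u) * (Z u - Z j)) ≡ (Z x - Z y) * (δ u x - δ u y)
sumTo-singleEdge m x y u Z (x≢y , x<m , y<m) = begin
  ∑[ j < m ] (δᶜ u j * (δ x u * δ y j + δ x j * δ y u) * (Z u - Z j))
    ≡⟨ sumTo-cong m (λ j → expand (δᶜ u j) (δ x u) (δ y j) (δ x j) (δ y u) (Z u) (Z j)) ⟩
  ∑[ j < m ] (δ x u * (δ y j * W j) + δ y u * (δ x j * W j))
    ≡⟨ sumTo-+ m (λ j → δ x u * (δ y j * W j)) (λ j → δ y u * (δ x j * W j)) ⟩
  ∑[ j < m ] (δ x u * (δ y j * W j)) + ∑[ j < m ] (δ y u * (δ x j * W j))
    ≡⟨ cong₂ _+_ (trans (sumTo-*ˡ m (δ x u) _) (cong (δ x u *_) (sumTo-δ m y W y<m)))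
                 (trans (sumTo-*ˡ m (δ y u) _) (cong (δ y u *_) (sumTo-δ m x W x<m))) ⟩
  δ x u * W y + δ y u * W x
    ≡⟨ cases ⟩
  (Z x - Z y) * (δ u x - δ u y)
    ∎
  where
  open ≡-Reasoning
  W : ℕ → ℤ
  W j = δᶜ u j * (Z u - Z j)
  expand : ∀ n a b c d zu zj → n * (a * b + c * d) * (zu - zj) ≡ a * (b * (n * (zu - zj))) + d * (c * (n * (zu - zj)))
  expand = solve-∀
  cases : δ x u * W y + δ y u * W x ≡ (Z x - Z y) * (δ u x - δ u y)
  cases with u ℕ.≟ x | u ℕ.≟ y
  ... | yes refl | yes refl = ⊥-elim (x≢y refl)
  ... | yes refl | no u≢y rewrite δ-refl u | δ-≢ u≢y | δ-≢ (≢-sym u≢y) | δᶜ-≢ u≢y = atTail (Z u) (Z y)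
    where
    atTail : ∀ a b → 1ℤ * (1ℤ * (a - b)) + 0ℤ * (0ℤ * (b - a)) ≡ (a - b) * (1ℤ - 0ℤ)
    atTail = solve-∀
  ... | no u≢x | yes refl rewrite δ-refl u | δ-≢ u≢x | δ-≢ (≢-sym u≢x) | δᶜ-≢ u≢x = atHead (Z u) (Z x)
    where
    atHead : ∀ a b → 0ℤ * (0ℤ * (a - a)) + 1ℤ * (1ℤ * (a - b)) ≡ (b - a) * (0ℤ - 1ℤ)
    atHead = solve-∀
  ... | no u≢x | no u≢y rewrite δ-≢ u≢x | δ-≢ u≢y | δ-≢ (≢-sym u≢x) | δ-≢ (≢-sym u≢y) =
    elsewhere (Z u) (Z x) (Z y) (δᶜ u y) (δᶜ u x)
    where
    elsewhere : ∀ a b c d e → 0ℤ * (d * (a - c)) + 0ℤ * (e * (a - b)) ≡ (b - c) * (0ℤ - 0ℤ)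
    elsewhere = solve-∀

sumTo-countEdges : ∀ m es u (Z : ℕ → ℤ) → All (ProperEdge m) es →
  ∑[ j < m ] (δᶜ u j * + countEdges es u j * (Z u - Z j))
    ≡ sumList es (λ e → ∂ₑ Z e * ∂ₑ (δ u) e)
sumTo-countEdges m [] u Z _ =
  trans (sumTo-cong m (λ j → trans (cong (_* (Z u - Z j)) (ℤP.*-zeroʳ (δᶜ u j))) (ℤP.*-zeroˡ (Z u - Z j))))
        (sumTo-zero m)
sumTo-countEdges m ((x , y) ∷ es) u Z (xy ∷ proper) = begin
  ∑[ j < m ] (δᶜ u j * + countEdges ((x , y) ∷ es) u j * (Z u - Z j))
    ≡⟨ sumTo-cong m (λ j → trans (cong (λ t → δᶜ u j * t * (Z u - Z j)) (pos-countEdges-∷ x y es u j (proj₁ xy)))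
                                 (distrib (δᶜ u j) (E j) (+ countEdges es u j) (Z u - Z j))) ⟩
  ∑[ j < m ] (δᶜ u j * E j * (Z u - Z j) + δᶜ u j * + countEdges es u j * (Z u - Z j))
    ≡⟨ sumTo-+ m (λ j → δᶜ u j * E j * (Z u - Z j)) (λ j → δᶜ u j * + countEdges es u j * (Z u - Z j)) ⟩
  ∑[ j < m ] (δᶜ u j * E j * (Z u - Z j)) + ∑[ j < m ] (δᶜ u j * + countEdges es u j * (Z u - Z j))
    ≡⟨ cong₂ _+_ (sumTo-singleEdge m x y u Z xy) (sumTo-countEdges m es u Z proper) ⟩
  (Z x - Z y) * (δ u x - δ u y) + sumList es (λ e → ∂ₑ Z e * ∂ₑ (δ u) e)
    ∎
  where
  open ≡-Reasoning
  E : ℕ → ℤ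
  E j = δ x u * δ y j + δ x j * δ y u
  distrib : ∀ n a b w → n * (a + b) * w ≡ n * a * w + n * b * w
  distrib = solve-∀

module _ {n} (es : List (ℕ × ℕ)) (proper : All (ProperEdge (suc n)) es) where

  fromEdges-· : ∀ (z : ZVec n) (i : Fin n) →
    (reduced (laplacian {suc n} (fromEdges es)) · z) i
      ≡ sumList es (λ e → ∂ₑ (extend z) e * ∂ₑ (δ (suc (toℕ i))) e)
  fromEdges-· z i =
    trans (reducedLaplacian-· (fromEdges es) (countEdges es) (λ _ _ → refl) z i)
          (sumTo-countEdges (suc n) es (suc (toℕ i)) (extend z) proper)

  fromEdges-dirichlet : ∀ (z : ZVec n) (τ : ℕ → ℤ) → τ 0 ≡ 0ℤ →
    sumℤ (λ i → (reduced (laplacian {suc n} (fromEdges es)) · z) i * τ (suc (toℕ i)))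
      ≡ sumList es (λ e → ∂ₑ (extend z) e * ∂ₑ τ e)
  fromEdges-dirichlet z τ τ0 = begin
    sumℤ (λ i → (reduced (laplacian {suc n} (fromEdges es)) · z) i * τ (suc (toℕ i)))
      ≡⟨ sumℤ-cong (λ i → cong (_* τ (suc (toℕ i))) (fromEdges-· z i)) ⟩
    sumℤ {n} (λ i → g (toℕ i))
      ≡⟨ sumℤ-sumTo n g ⟩
    sumTo n g
      ≡⟨ sumTo-cong n (λ v → sumList-*ʳ es (τ (suc v)) (λ e → W e * ∂ₑ (δ (suc v)) e)) ⟩
    ∑[ v < n ] sumList es (λ e → W e * ∂ₑ (δ (suc v)) e * τ (suc v))
      ≡⟨ sumTo-sumList n es (λ v e → W e * ∂ₑ (δ (suc v)) e * τ (suc v)) ⟩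
    sumList es (λ e → ∑[ v < n ] (W e * ∂ₑ (δ (suc v)) e * τ (suc v)))
      ≡⟨ sumList-congAll es proper edge ⟩
    sumList es (λ e → W e * ∂ₑ τ e)
      ∎
    where
    open ≡-Reasoning
    W : ℕ × ℕ → ℤ
    W e = ∂ₑ (extend z) e
    g : ℕ → ℤ
    g v = sumList es (λ e → W e * ∂ₑ (δ (suc v)) e) * τ (suc v)
    distrib : ∀ w a b t → w * (a - b) * t ≡ w * (a * t) - w * (b * t)
    distrib = solve-∀
    edge : ∀ e → ProperEdge (suc n) e →
      ∑[ v < n ] (W e * ∂ₑ (δ (suc v)) e * τ (suc v))
        ≡ W e * ∂ₑ τ e
    edge (x , y) (_ , x≤n , y≤n) = begin
      ∑[ v < n ] (W (x , y) * (δ (suc v) x - δ (suc v) y) * τ (suc v))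
        ≡⟨ sumTo-cong n (λ v → distrib (W (x , y)) (δ (suc v) x) (δ (suc v) y) (τ (suc v))) ⟩
      ∑[ v < n ] (W (x , y) * (δ (suc v) x * τ (suc v)) - W (x , y) * (δ (suc v) y * τ (suc v)))
        ≡⟨ sumTo-sub n _ _ ⟩
      ∑[ v < n ] (W (x , y) * (δ (suc v) x * τ (suc v))) - ∑[ v < n ] (W (x , y) * (δ (suc v) y * τ (suc v)))
        ≡⟨ cong₂ _-_ (sumTo-*ˡ n (W (x , y)) _) (sumTo-*ˡ n (W (x , y)) _) ⟩
      W (x , y) * ∑[ v < n ] (δ (suc v) x * τ (suc v)) - W (x , y) * ∑[ v < n ] (δ (suc v) y * τ (suc v))
        ≡⟨ sym (*-distribˡ-sub (W (x , y)) _ _) ⟩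
      W (x , y) * (∑[ v < n ] (δ (suc v) x * τ (suc v)) - ∑[ v < n ] (δ (suc v) y * τ (suc v)))
        ≡⟨ cong₂ (λ a b → W (x , y) * (a - b)) (sumTo-δ-suc n x τ τ0 x≤n) (sumTo-δ-suc n y τ τ0 y≤n) ⟩
      W (x , y) * (τ x - τ y)
        ∎

-- The thick cycle

nth : List ℕ → ℕ → ℕ
nth []       _       = 0
nth (x ∷ xs) zero    = x
nth (x ∷ xs) (suc l) = nth xs l

lookup-nth : ∀ {k} (s : Vec ℕ k) i → lookup s i ≡ nth (toList s) (toℕ i)
lookup-nth (x V.∷ s) zero    = refl
lookup-nth (x V.∷ s) (suc i) = lookup-nth s i

pos-if : ∀ b x → + (if b then x else 0) ≡ boolℤ b * + x
pos-if true  x = sym (ℤP.*-identityˡ (+ x))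
pos-if false x = sym (ℤP.*-zeroˡ (+ x))

boolℤ-∨-∧ₓ : ∀ a b c → a ∧ b ≡ false → boolℤ (a ∨ (b ∧ c)) ≡ boolℤ a + boolℤ b * boolℤ c
boolℤ-∨-∧ₓ true  true  c     ()
boolℤ-∨-∧ₓ true  false c     _ = refl
boolℤ-∨-∧ₓ false true  true  _ = refl
boolℤ-∨-∧ₓ false true  false _ = refl
boolℤ-∨-∧ₓ false false c     _ = refl

boolℤ-∨-false : ∀ b → boolℤ (b ∨ false) ≡ boolℤ b
boolℤ-∨-false true  = refl
boolℤ-∨-false false = refl

suc≡ᵇ-∧-≡ᵇ0 : ∀ u j → (suc u ≡ᵇ j) ∧ (j ≡ᵇ 0) ≡ false
suc≡ᵇ-∧-≡ᵇ0 u zero    = refl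
suc≡ᵇ-∧-≡ᵇ0 u (suc j) with suc u ≡ᵇ suc j
... | true  = refl
... | false = refl

boolℤ-≡ᵇ0 : ∀ j → boolℤ (j ≡ᵇ 0) ≡ δ 0 j
boolℤ-≡ᵇ0 zero    = refl
boolℤ-≡ᵇ0 (suc j) = refl

module ThickCycle (K : ℕ) (s : Vec ℕ (suc K)) where

  k : ℕ
  k = suc K

  sℕ : ℕ → ℕ
  sℕ = nth (toList s)

  Aℕ : ℕ → ℕ → ℕ
  Aℕ a b = (if isNext k a b then sℕ a else 0) ℕ.+ (if isNext k b a then sℕ b else 0)

  thickCycle≡Aℕ : ∀ i j → thickCycle s i j ≡ Aℕ (toℕ i) (toℕ j)
  thickCycle≡Aℕ i j =
    cong₂ (λ a b → (if isNext k (toℕ i) (toℕ j) then a else 0) ℕ.+ (if isNext k (toℕ j) (toℕ i) then b else 0))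
          (lookup-nth s i) (lookup-nth s j)

  module _ (Z : ℕ → ℤ) (c : ℕ) (c<K : c ℕ.< K) (Z0 : Z 0 ≡ 0ℤ) (Zk : Z k ≡ 0ℤ) where
    private
      u = suc c
      W : ℕ → ℤ
      W j = δᶜ u j * (Z u - Z j)
      wraps = boolℤ (suc u ≡ᵇ k)

      neighbourTerm : ∀ j → δᶜ u j * + Aℕ u j * (Z u - Z j) ≡
        + sℕ u * (δ (suc u) j * W j) + wraps * + sℕ u * (δ 0 j * W j) + δ c j * (+ sℕ j * W j)
      neighbourTerm j = begin
        δᶜ u j * + Aℕ u j * (Z u - Z j)
          ≡⟨ cong (λ t → δᶜ u j * t * (Z u - Z j))
                  (trans (ℤP.pos-+ (if isNext k u j then sℕ u else 0) (if isNext k j u then sℕ j else 0))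
                         (cong₂ _+_ (pos-if (isNext k u j) (sℕ u)) (pos-if (isNext k j u) (sℕ j)))) ⟩
        δᶜ u j * (boolℤ (isNext k u j) * + sℕ u + boolℤ (isNext k j u) * + sℕ j) * (Z u - Z j)
          ≡⟨ cong₂ (λ a b → δᶜ u j * (a * + sℕ u + b * + sℕ j) * (Z u - Z j))
                   (trans (boolℤ-∨-∧ₓ (suc u ≡ᵇ j) (j ≡ᵇ 0) (suc u ≡ᵇ k) (suc≡ᵇ-∧-≡ᵇ0 u j))
                          (cong (λ t → δ (suc u) j + t * wraps) (boolℤ-≡ᵇ0 j)))
                   (trans (boolℤ-∨-false (j ≡ᵇ c)) (δ-sym j c)) ⟩
        δᶜ u j * ((δ (suc u) j + δ 0 j * wraps) * + sℕ u + δ c j * + sℕ j) * (Z u - Z j)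
          ≡⟨ expand (δᶜ u j) (δ (suc u) j) (δ 0 j) wraps (+ sℕ u) (δ c j) (+ sℕ j) (Z u - Z j) ⟩
        + sℕ u * (δ (suc u) j * W j) + wraps * + sℕ u * (δ 0 j * W j) + δ c j * (+ sℕ j * W j)
          ∎
        where
        open ≡-Reasoning
        expand : ∀ n a b t s c s′ w →
          n * ((a + b * t) * s + c * s′) * w ≡ s * (a * (n * w)) + t * s * (b * (n * w)) + c * (s′ * (n * w))
        expand = solve-∀

      W-prev : W c ≡ Z u - Z c
      W-prev = trans (cong (_* (Z u - Z c)) (δᶜ-≢ (ℕP.1+n≢n {c}))) (ℤP.*-identityˡ _)
      W-0 : W 0 ≡ Z u
      W-0 = trans (ℤP.*-identityˡ _) (trans (cong (_-_ (Z u)) Z0) (ℤP.+-identityʳ (Z u)))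
      -- the successor of u is either an inner vertex, or vertex 0 reached by wrapping around
      nextNeighbour : + sℕ u * ∑[ j < k ] (δ (suc u) j * W j) + wraps * + sℕ u * W 0 + + sℕ c * W c
                        ≡ + sℕ c * (Z u - Z c) + + sℕ u * (Z u - Z (suc u))
      nextNeighbour with suc (suc c) ℕ.≤? K
      ... | yes u<K =
        trans (cong₂ _+_ (cong₂ _+_ (cong (+ sℕ u *_) (trans (sumTo-δ k (suc u) W (ℕ.s≤s u<K)) Wsu))
                                    (cong₂ (λ a b → a * + sℕ u * b) noWrap W-0))
                         (cong (+ sℕ c *_) W-prev))
              (inner (+ sℕ u) (+ sℕ c) (Z u) (Z (suc u)) (Z c))
        where
        Wsu : W (suc u) ≡ Z u - Z (suc u)
        Wsu = trans (cong (_* (Z u - Z (suc u))) (δᶜ-≢ {u} {suc u} (λ e → ℕP.1+n≢n (sym e))))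
                    (ℤP.*-identityˡ (Z u - Z (suc u)))
        noWrap : wraps ≡ 0ℤ
        noWrap = δ-≢ {suc u} {k} (λ e → ℕP.<⇒≢ (ℕ.s≤s u<K) e)
        inner : ∀ a b x y z → a * (x - y) + 0ℤ * a * x + b * (x - z) ≡ b * (x - z) + a * (x - y)
        inner = solve-∀
      ... | no u≮K =
        trans (cong₂ _+_ (cong₂ _+_ (cong (+ sℕ u *_) (sumTo-δ-beyond k (suc u) W (ℕ.s≤s K≤u)))
                                    (cong₂ (λ a b → a * + sℕ u * b) wrap W-0))
                         (cong (+ sℕ c *_) W-prev))
              (trans (last (+ sℕ u) (+ sℕ c) (Z u) (Z c))
                     (cong (λ t → + sℕ c * (Z u - Z c) + + sℕ u * (Z u - t)) (sym Zsu)))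
        where
        K≤u : K ℕ.≤ u
        K≤u = ℕP.≤-pred (ℕP.≰⇒> u≮K)
        su≡k : suc u ≡ k
        su≡k = cong suc (ℕP.≤-antisym c<K K≤u)
        wrap : wraps ≡ 1ℤ
        wrap = trans (cong (λ t → boolℤ (suc u ≡ᵇ t)) (sym su≡k)) (δ-refl (suc u))
        Zsu : Z (suc u) ≡ 0ℤ
        Zsu = trans (cong Z su≡k) Zk
        last : ∀ a b x z → a * 0ℤ + 1ℤ * a * x + b * (x - z) ≡ b * (x - z) + a * (x - 0ℤ)
        last = solve-∀

    neighbourSum : ∑[ j < k ] (δᶜ u j * + Aℕ u j * (Z u - Z j))
                     ≡ + sℕ c * (Z u - Z c) + + sℕ u * (Z u - Z (suc u))
    neighbourSum = begin
      ∑[ j < k ] (δᶜ u j * + Aℕ u j * (Z u - Z j))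
        ≡⟨ sumTo-cong k neighbourTerm ⟩
      ∑[ j < k ] (+ sℕ u * (δ (suc u) j * W j) + wraps * + sℕ u * (δ 0 j * W j) + δ c j * (+ sℕ j * W j))
        ≡⟨ trans (sumTo-+ k (λ j → next j + wrapped j) (λ j → δ c j * (+ sℕ j * W j)))
                 (cong (_+ ∑[ j < k ] (δ c j * (+ sℕ j * W j))) (sumTo-+ k next wrapped)) ⟩
      ∑[ j < k ] (+ sℕ u * (δ (suc u) j * W j)) + ∑[ j < k ] (wraps * + sℕ u * (δ 0 j * W j))
        + ∑[ j < k ] (δ c j * (+ sℕ j * W j))
        ≡⟨ cong₂ (λ a b → a + b + ∑[ j < k ] (δ c j * (+ sℕ j * W j)))
                 (sumTo-*ˡ k (+ sℕ u) (λ j → δ (suc u) j * W j))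
                 (trans (sumTo-*ˡ k (wraps * + sℕ u) (λ j → δ 0 j * W j))
                        (cong (wraps * + sℕ u *_) (sumTo-δ k 0 W (ℕ.s≤s ℕ.z≤n)))) ⟩
      + sℕ u * ∑[ j < k ] (δ (suc u) j * W j) + wraps * + sℕ u * W 0 + ∑[ j < k ] (δ c j * (+ sℕ j * W j))
        ≡⟨ cong (_+_ (+ sℕ u * ∑[ j < k ] (δ (suc u) j * W j) + wraps * + sℕ u * W 0))
                (sumTo-δ k c (λ j → + sℕ j * W j) (ℕP.m<n⇒m<1+n c<K)) ⟩
      + sℕ u * ∑[ j < k ] (δ (suc u) j * W j) + wraps * + sℕ u * W 0 + + sℕ c * W c
        ≡⟨ nextNeighbour ⟩
      + sℕ c * (Z u - Z c) + + sℕ u * (Z u - Z (suc u))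
        ∎
      where
      open ≡-Reasoning
      next wrapped : ℕ → ℤ
      next j = + sℕ u * (δ (suc u) j * W j)
      wrapped j = wraps * + sℕ u * (δ 0 j * W j)

  Δ꜀ : Mat K
  Δ꜀ = reduced (laplacian (thickCycle s))

  thickCycle-· : ∀ (z : ZVec K) (c : Fin K) → (Δ꜀ · z) c ≡
    + sℕ (toℕ c) * (extend z (suc (toℕ c)) - extend z (toℕ c))
      + + sℕ (suc (toℕ c)) * (extend z (suc (toℕ c)) - extend z (suc (suc (toℕ c))))
  thickCycle-· z c =
    trans (reducedLaplacian-· (thickCycle s) Aℕ thickCycle≡Aℕ z c)
          (neighbourSum (extend z) (toℕ c) (FP.toℕ<n c) refl (atℕ-beyond z))

  -- the preimage is the vector of partial sums of g
  thickCycle-image : ∀ (g : ℕ → ℤ) → sumTo k g ≡ 0ℤ →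
    (λ c → + sℕ (toℕ c) * g (toℕ c) - + sℕ (suc (toℕ c)) * g (suc (toℕ c))) ∈Im Δ꜀
  thickCycle-image g Σg≡0 = image z λ c → sym (begin
    (Δ꜀ · z) c
      ≡⟨ thickCycle-· z c ⟩
    + sℕ (toℕ c) * (extend z (suc (toℕ c)) - extend z (toℕ c))
      + + sℕ (suc (toℕ c)) * (extend z (suc (toℕ c)) - extend z (suc (suc (toℕ c))))
      ≡⟨ cong₂ (λ a b → + sℕ (toℕ c) * a + + sℕ (suc (toℕ c)) * b)
               (stepUp (toℕ c) (FP.toℕ<n c)) (stepDown (toℕ c) (FP.toℕ<n c)) ⟩
    + sℕ (toℕ c) * g (toℕ c) + + sℕ (suc (toℕ c)) * (- g (suc (toℕ c)))
      ≡⟨ cong (_+_ (+ sℕ (toℕ c) * g (toℕ c))) (sym (ℤP.neg-distribʳ-* (+ sℕ (suc (toℕ c))) _)) ⟩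
    + sℕ (toℕ c) * g (toℕ c) - + sℕ (suc (toℕ c)) * g (suc (toℕ c))
      ∎)
    where
    open ≡-Reasoning
    z : ZVec K
    z c = sumTo (suc (toℕ c)) g
    partial : ∀ v → v ℕ.≤ k → extend z v ≡ sumTo v g
    partial zero    _ = refl
    partial (suc v) sv≤k with suc v ℕ.≟ k
    ... | yes refl = trans (atℕ-beyond z) (sym Σg≡0)
    ... | no  sv≢k = atℕ-tabulate (λ x → sumTo (suc x) g) v (ℕP.≤-pred (ℕP.≤∧≢⇒< sv≤k sv≢k))
    stepUp : ∀ c → c ℕ.< K → extend z (suc c) - extend z c ≡ g c
    stepUp c c<K =
      trans (cong₂ _-_ (partial (suc c) (ℕP.m<n⇒m<1+n c<K))
                       (partial c (ℕP.≤-trans (ℕP.<⇒≤ c<K) (ℕP.n≤1+n K))))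
            (trans (cong (_- sumTo c g) (sumTo-last c g)) (cancel (sumTo c g) (g c)))
      where
      cancel : ∀ a b → a + b - a ≡ b
      cancel = solve-∀
    stepDown : ∀ c → c ℕ.< K → extend z (suc c) - extend z (suc (suc c)) ≡ - g (suc c)
    stepDown c c<K =
      trans (cong₂ _-_ (partial (suc c) (ℕP.m<n⇒m<1+n c<K)) (partial (suc (suc c)) (ℕ.s≤s c<K)))
            (trans (cong (_-_ (sumTo (suc c) g)) (sumTo-last (suc c) g)) (cancel (sumTo (suc c) g) (g (suc c))))
      where
      cancel : ∀ a b → a - (a + b) ≡ - b
      cancel = solve-∀

-- The subdivided banana graph

if-T : ∀ {A : Set} {b} {x y : A} → T b → (if b then x else y) ≡ x
if-T {b = true} _ = refl

if-¬T : ∀ {A : Set} {b} {x y : A} → ¬ T b → (if b then x else y) ≡ y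
if-¬T {b = true}  ¬t = ⊥-elim (¬t tt)
if-¬T {b = false} _  = refl

≤ᵇ-refl : ∀ s → T (s ≤ᵇ s)
≤ᵇ-refl s = ℕP.≤⇒≤ᵇ (ℕP.≤-refl {s})

-- vertex j ∈ [0, s] of a path of length s from a to b whose internal vertices are o, o + 1, …
pathVertex : ℕ → ℕ → ℕ → ℕ
pathVertex o s zero    = 0
pathVertex o s (suc j) = if s ≤ᵇ suc j then 1 else o ℕ.+ j

pathVertex-end : ∀ o s → 1 ℕ.≤ s → pathVertex o s s ≡ 1
pathVertex-end o (suc t) _ = if-T (≤ᵇ-refl (suc t))

pathSum : ℕ → ℕ → (ℕ × ℕ → ℤ) → ℤ
pathSum o s G = ∑[ j < s ] G (pathVertex o s j , pathVertex o s (suc j))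

chainVertex : ℕ → ℕ → ℕ → ℕ → ℕ
chainVertex o t b j = if t <ᵇ j then b else o ℕ.+ j

sumList-chain : ∀ o t b (G : ℕ × ℕ → ℤ) →
  sumList (chain o t b) G ≡ ∑[ j < suc t ] G (chainVertex o t b j , chainVertex o t b (suc j))
sumList-chain o zero b G =
  trans (ℤP.+-identityʳ _) (sym (trans (ℤP.+-identityʳ _) (cong (λ v → G (v , b)) (ℕP.+-identityʳ o))))
sumList-chain o (suc t) b G =
  cong₂ _+_ (cong₂ (λ v w → G (v , w)) (sym (ℕP.+-identityʳ o)) (sym (ℕP.+-comm o 1)))
            (trans (sumList-chain (suc o) t b G)
                   (sumTo-cong (suc t) (λ j → cong₂ (λ v w → G (v , w)) (shift j) (shift (suc j)))))
  where
  shift : ∀ j → chainVertex (suc o) t b j ≡ chainVertex o (suc t) b (suc j)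
  shift j with t <ᵇ j
  ... | true  = refl
  ... | false = sym (ℕP.+-suc o j)

sumList-pathEdges : ∀ o s (G : ℕ × ℕ → ℤ) → 1 ℕ.≤ s → sumList (pathEdges 0 1 o s) G ≡ pathSum o s G
sumList-pathEdges o (suc zero)    G _ = refl
sumList-pathEdges o (suc (suc t)) G _ =
  cong₂ _+_ (cong (λ v → G (0 , v)) (sym (ℕP.+-identityʳ o))) (sumList-chain o t 1 G)

pathOffset : ℕ → List ℕ → ℕ → ℕ
pathOffset o []       l       = o
pathOffset o (s ∷ ss) zero    = o
pathOffset o (s ∷ ss) (suc l) = pathOffset (o ℕ.+ (s ∸ 1)) ss l

sumList-bananaEdges : ∀ o ss (G : ℕ × ℕ → ℤ) → All (1 ℕ.≤_) ss →
  sumList (bananaEdges o ss) G ≡ ∑[ l < length ss ] pathSum (pathOffset o ss l) (nth ss l) G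
sumList-bananaEdges o []       G []         = refl
sumList-bananaEdges o (s ∷ ss) G (1≤s ∷ 1≤) =
  trans (sumList-++ (pathEdges 0 1 o s) _ G)
        (cong₂ _+_ (sumList-pathEdges o s G 1≤s) (sumList-bananaEdges (o ℕ.+ (s ∸ 1)) ss G 1≤))

pathOffset-bound : ∀ o ss l → l ℕ.< length ss →
  pathOffset o ss l ℕ.+ (nth ss l ∸ 1) ℕ.≤ o ℕ.+ internalCount ss
pathOffset-bound o (s ∷ ss) zero    _         = ℕP.+-monoʳ-≤ o (ℕP.m≤m+n (s ∸ 1) (internalCount ss))
pathOffset-bound o (s ∷ ss) (suc l) (ℕ.s≤s p) =
  ℕP.≤-trans (pathOffset-bound (o ℕ.+ (s ∸ 1)) ss l p) (ℕP.≤-reflexive (ℕP.+-assoc o (s ∸ 1) (internalCount ss)))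

pathVertex-bound : ∀ o s j m → 2 ℕ.≤ m → o ℕ.+ (s ∸ 1) ℕ.≤ m → pathVertex o s j ℕ.< m
pathVertex-bound o s zero    m 2≤m _ = ℕP.≤-trans (ℕ.s≤s ℕ.z≤n) 2≤m
pathVertex-bound o s (suc j) m 2≤m bound with s ≤ᵇ suc j in eq
... | true  = 2≤m
... | false = ℕP.<-≤-trans (ℕP.+-monoʳ-< o j<s-1) bound
  where
  j<s-1 : j ℕ.< s ∸ 1
  j<s-1 = ℕP.∸-monoˡ-≤ {suc (suc j)} {s} 1 (ℕP.≰⇒> (λ t → subst T eq (ℕP.≤⇒≤ᵇ t)))

chain-proper : ∀ o t m → 2 ℕ.≤ o → o ℕ.+ suc t ℕ.≤ m → All (ProperEdge m) (chain o t 1)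
chain-proper o zero m 2≤o bound =
  ( (λ e → ℕP.<⇒≢ (ℕP.≤-trans (ℕ.s≤s (ℕ.s≤s ℕ.z≤n)) 2≤o) (sym e))
  , ℕP.≤-trans (ℕP.≤-reflexive (ℕP.+-comm 1 o)) bound
  , ℕP.<-≤-trans (ℕ.s≤s (ℕ.s≤s ℕ.z≤n)) (ℕP.≤-trans 2≤o (ℕP.≤-trans (ℕP.m≤m+n o 1) bound))) ∷ []
chain-proper o (suc t) m 2≤o bound =
  ( (λ e → ℕP.1+n≢n (sym e))
  , ℕP.≤-trans (ℕP.≤-trans (ℕP.≤-reflexive (ℕP.+-comm 1 o)) (ℕP.+-monoʳ-≤ o (ℕ.s≤s ℕ.z≤n))) bound
  , ℕP.≤-trans (ℕP.≤-trans (ℕP.≤-reflexive (ℕP.+-comm 2 o)) (ℕP.+-monoʳ-≤ o (ℕ.s≤s (ℕ.s≤s ℕ.z≤n))))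
               bound)
  ∷ chain-proper (suc o) t m (ℕP.≤-trans 2≤o (ℕP.n≤1+n o))
                 (ℕP.≤-trans (ℕP.≤-reflexive (sym (ℕP.+-suc o (suc t)))) bound)

bananaEdges-proper : ∀ o ss m → 2 ℕ.≤ o → All (1 ℕ.≤_) ss → o ℕ.+ internalCount ss ℕ.≤ m →
  All (ProperEdge m) (bananaEdges o ss)
bananaEdges-proper o []       m _   _            _     = []
bananaEdges-proper o (s ∷ ss) m 2≤o (1≤s ∷ 1≤ss) bound =
  AllP.++⁺ (path s 1≤s (ℕP.≤-trans (ℕP.+-monoʳ-≤ o (ℕP.m≤m+n (s ∸ 1) (internalCount ss))) bound))
           (bananaEdges-proper (o ℕ.+ (s ∸ 1)) ss m (ℕP.≤-trans 2≤o (ℕP.m≤m+n o (s ∸ 1))) 1≤ss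
                               (ℕP.≤-trans (ℕP.≤-reflexive (ℕP.+-assoc o (s ∸ 1) (internalCount ss))) bound))
  where
  2≤m : 2 ℕ.≤ m
  2≤m = ℕP.≤-trans 2≤o (ℕP.≤-trans (ℕP.m≤m+n o _) bound)
  path : ∀ s′ → 1 ℕ.≤ s′ → o ℕ.+ (s′ ∸ 1) ℕ.≤ m → All (ProperEdge m) (pathEdges 0 1 o s′)
  path (suc zero)    _ _ = ((λ ()) , ℕP.≤-trans (ℕ.s≤s ℕ.z≤n) 2≤m , 2≤m) ∷ []
  path (suc (suc t)) _ b =
    ( (λ e → ℕP.<⇒≢ (ℕP.≤-trans (ℕ.s≤s ℕ.z≤n) 2≤o) e)
    , ℕP.≤-trans (ℕ.s≤s ℕ.z≤n) 2≤m
    , ℕP.≤-trans (ℕP.≤-trans (ℕP.≤-reflexive (ℕP.+-comm 1 o)) (ℕP.+-monoʳ-≤ o (ℕ.s≤s ℕ.z≤n))) b)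
    ∷ chain-proper o t m 2≤o b

-- value h l j at the j-th vertex of the l-th path, the paths in ss being numbered from l on
internalPotential : ℕ → List ℕ → ℕ → (ℕ → ℕ → ℤ) → ℕ → ℤ
internalPotential o []       l h v = 0ℤ
internalPotential o (s ∷ ss) l h v =
  if v <ᵇ o ℕ.+ (s ∸ 1) then h l (suc (v ∸ o)) else internalPotential (o ℕ.+ (s ∸ 1)) ss (suc l) h v

bananaPotential : List ℕ → (ℕ → ℕ → ℤ) → ℤ → ℕ → ℤ
bananaPotential L h hb zero          = 0ℤ
bananaPotential L h hb (suc zero)    = hb
bananaPotential L h hb (suc (suc w)) = internalPotential 2 L 0 h (suc (suc w))

pathProfile : ℕ → (ℕ → ℤ) → ℤ → ℕ → ℤ
pathProfile s g hb zero    = 0ℤ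
pathProfile s g hb (suc j) = if s ≤ᵇ suc j then hb else g (suc j)

module _ (h : ℕ → ℕ → ℤ) (hb : ℤ) (g : ℕ → ℤ) (g0 : g 0 ≡ 0ℤ) (g1 : g 1 ≡ hb) where

  potential-firstPath : ∀ o s ss l → (∀ v → o ℕ.≤ v → g v ≡ internalPotential o (s ∷ ss) l h v) →
    ∀ j → g (pathVertex o s j) ≡ pathProfile s (h l) hb j
  potential-firstPath o s ss l g≡ zero = g0
  potential-firstPath o s ss l g≡ (suc j) with s ≤ᵇ suc j in eq
  ... | true  = g1
  ... | false =
    trans (g≡ (o ℕ.+ j) (ℕP.m≤m+n o j))
          (trans (if-T (ℕP.<⇒<ᵇ (ℕP.+-monoʳ-< o j<s-1))) (cong (λ t → h l (suc t)) (ℕP.m+n∸m≡n o j)))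
    where
    j<s-1 : j ℕ.< s ∸ 1
    j<s-1 = ℕP.∸-monoˡ-≤ {suc (suc j)} {s} 1 (ℕP.≰⇒> (λ q → subst T eq (ℕP.≤⇒≤ᵇ q)))

  potential-pathVertex : ∀ o ss l₀ l → (∀ v → o ℕ.≤ v → g v ≡ internalPotential o ss l₀ h v) →
    l ℕ.< length ss → ∀ j →
    g (pathVertex (pathOffset o ss l) (nth ss l) j) ≡ pathProfile (nth ss l) (h (l₀ ℕ.+ l)) hb j
  potential-pathVertex o (s ∷ ss) l₀ zero g≡ _ j =
    trans (potential-firstPath o s ss l₀ g≡ j) (cong (λ x → pathProfile s (h x) hb j) (sym (ℕP.+-identityʳ l₀)))
  potential-pathVertex o (s ∷ ss) l₀ (suc l) g≡ (ℕ.s≤s l<) j =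
    trans (potential-pathVertex (o ℕ.+ (s ∸ 1)) ss (suc l₀) l g≡′ l< j)
          (cong (λ x → pathProfile (nth ss l) (h x) hb j) (sym (ℕP.+-suc l₀ l)))
    where
    g≡′ : ∀ v → o ℕ.+ (s ∸ 1) ℕ.≤ v → g v ≡ internalPotential (o ℕ.+ (s ∸ 1)) ss (suc l₀) h v
    g≡′ v p =
      trans (g≡ v (ℕP.≤-trans (ℕP.m≤m+n o (s ∸ 1)) p)) (if-¬T (λ q → ℕP.<⇒≱ (ℕP.<ᵇ⇒< v _ q) p))

bananaPotential-pathVertex : ∀ L h hb l → l ℕ.< length L → ∀ j →
  bananaPotential L h hb (pathVertex (pathOffset 2 L l) (nth L l) j) ≡ pathProfile (nth L l) (h l) hb j
bananaPotential-pathVertex L h hb l l< j =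
  potential-pathVertex h hb (bananaPotential L h hb) refl refl 2 L 0 l internal l< j
  where
  internal : ∀ v → 2 ℕ.≤ v → bananaPotential L h hb v ≡ internalPotential 2 L 0 h v
  internal (suc zero)    (ℕ.s≤s ())
  internal (suc (suc w)) _ = refl

record OnPath (o : ℕ) (ss : List ℕ) (l₀ v : ℕ) : Set where
  field
    path      : ℕ
    step      : ℕ
    path<     : path ℕ.< length ss
    1≤step    : 1 ℕ.≤ step
    step<     : step ℕ.< nth ss path
    vertex≡   : pathVertex (pathOffset o ss path) (nth ss path) step ≡ v
    potential : ∀ h → internalPotential o ss l₀ h v ≡ h (l₀ ℕ.+ path) step

onPath : ∀ o ss l₀ v → o ℕ.≤ v → v ℕ.< o ℕ.+ internalCount ss → OnPath o ss l₀ v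
onPath o []       l₀ v o≤v v< = ⊥-elim (ℕP.<⇒≱ v< (ℕP.≤-trans (ℕP.≤-reflexive (ℕP.+-identityʳ o)) o≤v))
onPath o (s ∷ ss) l₀ v o≤v v< with v ℕ.<? o ℕ.+ (s ∸ 1)
... | yes v<o+s = record
  { path      = 0
  ; step      = suc (v ∸ o)
  ; path<     = ℕ.s≤s ℕ.z≤n
  ; 1≤step    = ℕ.s≤s ℕ.z≤n
  ; step<     = step<s s v<o+s
  ; vertex≡   = trans (if-¬T (λ t → ℕP.<⇒≱ (step<s s v<o+s) (ℕP.≤ᵇ⇒≤ s (suc (v ∸ o)) t)))
                      (ℕP.m+[n∸m]≡n o≤v)
  ; potential = λ h → trans (if-T (ℕP.<⇒<ᵇ v<o+s)) (cong (λ x → h x (suc (v ∸ o))) (sym (ℕP.+-identityʳ l₀)))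
  }
  where
  step<s : ∀ s′ → suc v ℕ.≤ o ℕ.+ (s′ ∸ 1) → suc (v ∸ o) ℕ.< s′
  step<s zero     r = ⊥-elim (ℕP.<⇒≱ r (ℕP.≤-trans (ℕP.≤-reflexive (ℕP.+-identityʳ o)) o≤v))
  step<s (suc s′) r =
    ℕ.s≤s (subst (ℕ._≤ s′) (ℕP.+-∸-assoc 1 o≤v)
                 (ℕP.≤-trans (ℕP.∸-monoˡ-≤ o r) (ℕP.≤-reflexive (ℕP.m+n∸m≡n o s′))))
... | no v≮o+s =
  let rest = onPath (o ℕ.+ (s ∸ 1)) ss (suc l₀) v (ℕP.≮⇒≥ v≮o+s)
                    (ℕP.<-≤-trans v< (ℕP.≤-reflexive (sym (ℕP.+-assoc o (s ∸ 1) (internalCount ss)))))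
      open OnPath rest
  in record
  { path      = suc path
  ; step      = step
  ; path<     = ℕ.s≤s path<
  ; 1≤step    = 1≤step
  ; step<     = step<
  ; vertex≡   = vertex≡
  ; potential = λ h → trans (if-¬T (λ t → v≮o+s (ℕP.<ᵇ⇒< v _ t)))
                            (trans (potential h) (cong (λ x → h x step) (sym (ℕP.+-suc l₀ path))))
  }

pathSum-linear : ∀ s (F : ℕ → ℤ) (U Tb : ℤ) → 1 ℕ.≤ s →
  ∑[ j < s ] (∂ F j * ∂ (pathProfile s (λ j → + j * U) Tb) j)
    ≡ F s * U + (F (s ∸ 1) - F s) * (+ s * U - Tb) - F 0 * U
pathSum-linear (suc t) F U Tb _ = begin
  sumTo (suc t) f
    ≡⟨ sumTo-last t f ⟩
  sumTo t f + f t
    ≡⟨ cong₂ _+_ inner (cong (∂ F t *_) (cong₂ _-_ (P-linear t ℕP.≤-refl) (if-T (≤ᵇ-refl (suc t))))) ⟩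
  (F 0 - F t) * (- U) + (F t - F (suc t)) * (+ t * U - Tb)
    ≡⟨ regroup (F 0) (F t) (F (suc t)) U Tb (+ t) ⟩
  F (suc t) * U + (F t - F (suc t)) * ((1ℤ + + t) * U - Tb) - F 0 * U
    ≡⟨ cong (λ x → F (suc t) * U + (F t - F (suc t)) * (x * U - Tb) - F 0 * U) (sym (ℤP.pos-+ 1 t)) ⟩
  F (suc t) * U + (F t - F (suc t)) * (+ suc t * U - Tb) - F 0 * U
    ∎
  where
  open ≡-Reasoning
  P = pathProfile (suc t) (λ j → + j * U) Tb
  f : ℕ → ℤ
  f j = (F j - F (suc j)) * (P j - P (suc j))
  P-linear : ∀ j → j ℕ.≤ t → P j ≡ + j * U
  P-linear zero    _   = sym (ℤP.*-zeroˡ U)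
  P-linear (suc j) j<t = if-¬T (λ q → ℕP.<⇒≱ (ℕ.s≤s j<t) (ℕP.≤ᵇ⇒≤ (suc t) (suc j) q))
  slope : ∀ j → + j * U - + suc j * U ≡ - U
  slope j = trans (cong (λ x → + j * U - x * U) (ℤP.pos-+ 1 j)) (step (+ j) U)
    where
    step : ∀ a u → a * u - (1ℤ + a) * u ≡ - u
    step = solve-∀
  inner : sumTo t f ≡ (F 0 - F t) * (- U)
  inner =
    trans (sumTo-cong< t (λ j j<t → cong (λ x → (F j - F (suc j)) * x)
                                        (trans (cong₂ _-_ (P-linear j (ℕP.<⇒≤ j<t)) (P-linear (suc j) j<t)) (slope j))))
          (trans (sumTo-*ʳ t (- U) (λ j → F j - F (suc j))) (cong (_* (- U)) (sumTo-telescope t F)))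
  regroup : ∀ f0 ft fs u tb a →
    (f0 - ft) * (- u) + (ft - fs) * (a * u - tb) ≡ fs * u + (ft - fs) * ((1ℤ + a) * u - tb) - f0 * u
  regroup = solve-∀

pathSum-ramp : ∀ s J (W : ℕ → ℤ) → 1 ℕ.≤ J → J ℕ.≤ s → W 0 ≡ 0ℤ →
  ∑[ j < s ] (∂ W j * ∂ (pathProfile s (λ j → + (J ∸ j)) 0ℤ) j)
    ≡ + J * W 1 - W J
pathSum-ramp (suc s) (suc J) W _ (ℕ.s≤s J≤s) W0 = begin
  ∑[ j < suc s ] ((W j - W (suc j)) * (G j - G (suc j)))
    ≡⟨ sumTo-cong (suc s) (λ j → cong₂ (λ a b → (W j - W (suc j)) * (a - b)) (G≡ j) (G≡ (suc j))) ⟩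
  (W 0 - W 1) * (0ℤ - + J) + ∑[ j < s ] ((W (suc j) - W (suc (suc j))) * (+ (J ∸ j) - + (J ∸ suc j)))
    ≡⟨ cong (_+_ ((W 0 - W 1) * (0ℤ - + J)))
            (trans (sumTo-*-rampStep s J (λ j → ∂ W (suc j)) J≤s) (sumTo-telescope J (λ j → W (suc j)))) ⟩
  (W 0 - W 1) * (0ℤ - + J) + (W 1 - W (suc J))
    ≡⟨ cong (λ x → (x - W 1) * (0ℤ - + J) + (W 1 - W (suc J))) W0 ⟩
  (0ℤ - W 1) * (0ℤ - + J) + (W 1 - W (suc J))
    ≡⟨ regroup (W 1) (W (suc J)) (+ J) ⟩
  (1ℤ + + J) * W 1 - W (suc J)
    ≡⟨ cong (λ x → x * W 1 - W (suc J)) (sym (ℤP.pos-+ 1 J)) ⟩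
  + suc J * W 1 - W (suc J)
    ∎
  where
  open ≡-Reasoning
  G = pathProfile (suc s) (λ j → + (suc J ∸ j)) 0ℤ
  G′ : ℕ → ℤ
  G′ zero    = 0ℤ
  G′ (suc j) = + (J ∸ j)
  G≡ : ∀ j → G j ≡ G′ j
  G≡ zero = refl
  G≡ (suc j) with suc s ≤ᵇ suc j in eq
  ... | true  =
    cong +_ (sym (ℕP.m≤n⇒m∸n≡0 (ℕP.≤-trans (ℕ.s≤s J≤s)
                                          (ℕP.≤ᵇ⇒≤ (suc s) (suc j) (subst T (sym eq) _)))))
  ... | false = refl
  regroup : ∀ w1 wj a → (0ℤ - w1) * (0ℤ - a) + (w1 - wj) ≡ (1ℤ + a) * w1 - wj
  regroup = solve-∀

pathSum-constant : ∀ s (W : ℕ → ℤ) → 1 ℕ.≤ s → W 0 ≡ 0ℤ →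
  ∑[ j < s ] (∂ W j * ∂ (pathProfile s (λ _ → 1ℤ) 1ℤ) j) ≡ W 1
pathSum-constant (suc t) W _ W0 =
  trans (cong₂ _+_ (cong (λ b → (W 0 - W 1) * (0ℤ - b)) (one 0))
                   (trans (sumTo-cong t (λ j → trans (cong₂ (λ a b → ∂ W (suc j) * (a - b)) (one j) (one (suc j)))
                                                     (flat (W (suc j) - W (suc (suc j))))))
                          (sumTo-zero t)))
        (trans (cong (λ x → (x - W 1) * (0ℤ - 1ℤ) + 0ℤ) W0) (firstEdge (W 1)))
  where
  one : ∀ j → pathProfile (suc t) (λ _ → 1ℤ) 1ℤ (suc j) ≡ 1ℤ
  one j with suc t ≤ᵇ suc j
  ... | true  = refl
  ... | false = refl
  flat : ∀ x → x * (1ℤ - 1ℤ) ≡ 0ℤ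
  flat = solve-∀
  firstEdge : ∀ w → (0ℤ - w) * (0ℤ - 1ℤ) + 0ℤ ≡ w
  firstEdge = solve-∀

pathProfile-scale : ∀ s c (g : ℕ → ℤ) j → pathProfile s (λ j → c * g j) 0ℤ j ≡ c * pathProfile s g 0ℤ j
pathProfile-scale s c g zero = sym (ℤP.*-zeroʳ c)
pathProfile-scale s c g (suc j) with s ≤ᵇ suc j
... | true  = sym (ℤP.*-zeroʳ c)
... | false = refl

-- The isomorphism

module BananaToCycle (K : ℕ) (s : Vec ℕ (suc K)) (1≤s : ∀ l → 1 ℕ.≤ lookup s l) where

  open ThickCycle K s

  L : List ℕ
  L = toList s

  n : ℕ
  n = suc (internalCount L)

  length-L : length L ≡ k
  length-L = VP.length-toList s

  1≤sℕ : ∀ l → l ℕ.< k → 1 ℕ.≤ sℕ l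
  1≤sℕ l l<k =
    subst (1 ℕ.≤_) (trans (lookup-nth s (fromℕ< l<k)) (cong sℕ (FP.toℕ-fromℕ< l<k))) (1≤s (fromℕ< l<k))

  1≤L : All (1 ℕ.≤_) L
  1≤L = fromLookup 1≤s
    where
    fromLookup : ∀ {m} {v : Vec ℕ m} → (∀ l → 1 ℕ.≤ lookup v l) → All (1 ℕ.≤_) (toList v)
    fromLookup {v = V.[]}    _ = []
    fromLookup {v = x V.∷ v} p = p zero ∷ fromLookup (λ l → p (suc l))

  proper : All (ProperEdge (suc n)) (bananaEdges 2 L)
  proper = bananaEdges-proper 2 L (suc n) ℕP.≤-refl 1≤L ℕP.≤-refl

  Δᵦ : Mat n
  Δᵦ = reduced (laplacian (banana s))

  offset : ℕ → ℕ
  offset = pathOffset 2 L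

  vertex : ℕ → ℕ → ℕ
  vertex l = pathVertex (offset l) (sℕ l)

  vertex-end : ∀ l → l ℕ.< k → vertex l (sℕ l) ≡ 1
  vertex-end l l<k = pathVertex-end (offset l) (sℕ l) (1≤sℕ l l<k)

  vertex-bound : ∀ l j → l ℕ.< k → vertex l j ℕ.< suc n
  vertex-bound l j l<k =
    pathVertex-bound (offset l) (sℕ l) j (suc n) (ℕ.s≤s (ℕ.s≤s ℕ.z≤n))
                     (pathOffset-bound 2 L l (subst (l ℕ.<_) (sym length-L) l<k))

  potential-vertex : ∀ h hb l → l ℕ.< k → ∀ j →
    bananaPotential L h hb (vertex l j) ≡ pathProfile (sℕ l) (h l) hb j
  potential-vertex h hb l l<k = bananaPotential-pathVertex L h hb l (subst (l ℕ.<_) (sym length-L) l<k)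

  onReduced : (ℕ → ℤ) → ZVec n
  onReduced f i = f (suc (toℕ i))

  Δᵦ-potential : ∀ h hb (i : Fin n) → (Δᵦ · onReduced (bananaPotential L h hb)) i ≡
    ∑[ l < k ] ∑[ j < sℕ l ] (∂ (δ (suc (toℕ i)) ∘ vertex l) j * ∂ (pathProfile (sℕ l) (h l) hb) j)
  Δᵦ-potential h hb i = begin
    (Δᵦ · onReduced P) i
      ≡⟨ fromEdges-· (bananaEdges 2 L) proper (onReduced P) i ⟩
    sumList (bananaEdges 2 L) (λ e → ∂ₑ (extend (onReduced P)) e * ∂ₑ (δ w) e)
      ≡⟨ sumList-congAll (bananaEdges 2 L) proper (λ e (_ , x< , y<) →
           trans (cong₂ (λ a b → (a - b) * ∂ₑ (δ w) e)
                        (extend-tabulate P refl (proj₁ e) x<) (extend-tabulate P refl (proj₂ e) y<))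
                 (ℤP.*-comm (∂ₑ P e) _)) ⟩
    sumList (bananaEdges 2 L) G
      ≡⟨ sumList-bananaEdges 2 L G 1≤L ⟩
    ∑[ l < length L ] pathSum (pathOffset 2 L l) (nth L l) G
      ≡⟨ cong (λ m → ∑[ l < m ] pathSum (offset l) (sℕ l) G) length-L ⟩
    ∑[ l < k ] pathSum (offset l) (sℕ l) G
      ≡⟨ sumTo-cong< k (λ l l<k → sumTo-cong (sℕ l) (λ j →
           cong₂ (λ a b → (δ w (vertex l j) - δ w (vertex l (suc j))) * (a - b))
                 (potential-vertex h hb l l<k j) (potential-vertex h hb l l<k (suc j)))) ⟩
    ∑[ l < k ] ∑[ j < sℕ l ] (∂ (δ w ∘ vertex l) j * ∂ (pathProfile (sℕ l) (h l) hb) j)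
      ∎
    where
    open ≡-Reasoning
    w = suc (toℕ i)
    P = bananaPotential L h hb
    G : ℕ × ℕ → ℤ
    G e = ∂ₑ (δ w) e * ∂ₑ P e

  firstVertex : ℕ → ℕ
  firstVertex l = vertex l 1

  -- the potential J ∸ j on path l and 0 elsewhere
  ramp-image : ∀ l → l ℕ.< k → ∀ J → 1 ℕ.≤ J → J ℕ.≤ sℕ l →
    (λ i → + J * δ (suc (toℕ i)) (firstVertex l) - δ (suc (toℕ i)) (vertex l J)) ∈Im Δᵦ
  ramp-image l l<k J 1≤J J≤s = image (onReduced (bananaPotential L h 0ℤ)) λ i →
    sym (trans (Δᵦ-potential h 0ℤ i) (onPath-l (toℕ i)))
    where
    h : ℕ → ℕ → ℤ
    h l′ j = δ l l′ * + (J ∸ j)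
    ramp : ℕ → ℤ
    ramp j = + (J ∸ j)
    onPath-l : ∀ w →
      ∑[ l′ < k ] ∑[ j < sℕ l′ ] (∂ (δ (suc w) ∘ vertex l′) j * ∂ (pathProfile (sℕ l′) (h l′) 0ℤ) j)
        ≡ + J * δ (suc w) (firstVertex l) - δ (suc w) (vertex l J)
    onPath-l w = begin
      ∑[ l′ < k ] ∑[ j < sℕ l′ ] (D l′ j * ∂ (pathProfile (sℕ l′) (h l′) 0ℤ) j)
        ≡⟨ sumTo-cong k (λ l′ → trans (sumTo-cong (sℕ l′) (scaled l′))
                                      (sumTo-*ˡ (sℕ l′) (δ l l′) (rampSum l′))) ⟩
      ∑[ l′ < k ] (δ l l′ * sumTo (sℕ l′) (rampSum l′))
        ≡⟨ sumTo-δ k l (λ l′ → sumTo (sℕ l′) (rampSum l′)) l<k ⟩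
      sumTo (sℕ l) (rampSum l)
        ≡⟨ pathSum-ramp (sℕ l) J (δ (suc w) ∘ vertex l) 1≤J J≤s refl ⟩
      + J * δ (suc w) (firstVertex l) - δ (suc w) (vertex l J)
        ∎
      where
      open ≡-Reasoning
      D : ℕ → ℕ → ℤ
      D l′ = ∂ (δ (suc w) ∘ vertex l′)
      rampSum : ℕ → ℕ → ℤ
      rampSum l′ j = D l′ j * ∂ (pathProfile (sℕ l′) ramp 0ℤ) j
      factor : ∀ c d a b → d * (c * a - c * b) ≡ c * (d * (a - b))
      factor = solve-∀
      scaled : ∀ l′ j → D l′ j * ∂ (pathProfile (sℕ l′) (h l′) 0ℤ) j ≡ δ l l′ * rampSum l′ j
      scaled l′ j =
        trans (cong₂ (λ a b → D l′ j * (a - b)) (pathProfile-scale (sℕ l′) (δ l l′) ramp j)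
                                                (pathProfile-scale (sℕ l′) (δ l l′) ramp (suc j)))
              (factor (δ l l′) (D l′ j) _ _)

  -- the potential that is 1 everywhere except at a
  firstVertices-image : (λ i → ∑[ l < k ] δ (suc (toℕ i)) (firstVertex l)) ∈Im Δᵦ
  firstVertices-image = image (onReduced (bananaPotential L (λ _ _ → 1ℤ) 1ℤ)) λ i →
    sym (trans (Δᵦ-potential (λ _ _ → 1ℤ) 1ℤ i)
               (sumTo-cong< k (λ l l<k → pathSum-constant (sℕ l) (δ (suc (toℕ i)) ∘ vertex l) (1≤sℕ l l<k) refl)))

  U : ℕ → ℕ → ℤ
  U c l = δ c l - δ (suc c) l

  Tb : ℕ → ℤ
  Tb c = + sℕ 0 * U c 0

  R : ℕ → ℕ → ℤ
  R l c = + sℕ l * U c l - Tb c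

  slope : ℕ → ℕ → ℕ → ℤ
  slope c l j = + j * U c l

  -- τ c has slope U c l along path l, except on the last edge, where it jumps to the value Tb c
  -- at b; the jump is R l c.
  τ : ℕ → ℕ → ℤ
  τ c = bananaPotential L (slope c) (Tb c)

  φ : ℕ → ℕ → ℤ
  φ v w = ∑[ l < v ] δ w (firstVertex l)

  M : Fin n → Fin K → ℤ
  M i c = τ (toℕ c) (suc (toℕ i))

  N : Fin K → Fin n → ℤ
  N c i = φ (suc (toℕ c)) (suc (toℕ i))

  sumTo-U : ∀ c → c ℕ.< K → ∑[ l < k ] U c l ≡ 0ℤ
  sumTo-U c c<K =
    trans (sumTo-sub k (δ c) (δ (suc c)))
          (trans (cong₂ _-_ (sumTo-δ-const′ c (ℕP.m<n⇒m<1+n c<K)) (sumTo-δ-const′ (suc c) (ℕ.s≤s c<K)))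
                 (ℤP.+-inverseʳ 1ℤ))
    where
    sumTo-δ-const′ : ∀ u → u ℕ.< k → ∑[ l < k ] δ u l ≡ 1ℤ
    sumTo-δ-const′ u u<k = trans (sumTo-cong k (λ l → δ-sym u l)) (sumTo-δ-const k u u<k)

  sumTo-U-prefix : ∀ c m → ∑[ l < suc m ] U c l ≡ δ c m
  sumTo-U-prefix c zero = cancel (δ c 0)
    where
    cancel : ∀ a → a - 0ℤ + 0ℤ ≡ a
    cancel = solve-∀
  sumTo-U-prefix c (suc m) =
    trans (sumTo-last (suc m) (U c))
          (trans (cong (_+ U c (suc m)) (sumTo-U-prefix c m)) (cancel (δ c m) (δ c (suc m))))
    where
    cancel : ∀ a b → a + (b - a) ≡ b
    cancel = solve-∀

  R-image : ∀ l → l ℕ.< k → (λ c → R l (toℕ c)) ∈Im Δ꜀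
  R-image l l<k = ∈Im-cong (λ c → R≡ (toℕ c)) (thickCycle-image g Σg≡0)
    where
    g : ℕ → ℤ
    g v = δ v l - δ v 0
    Σg≡0 : sumTo k g ≡ 0ℤ
    Σg≡0 = trans (sumTo-sub k (λ v → δ v l) (λ v → δ v 0))
                 (trans (cong₂ _-_ (sumTo-δ-const k l l<k) (sumTo-δ-const k 0 (ℕ.s≤s ℕ.z≤n))) (ℤP.+-inverseʳ 1ℤ))
    σ : ℕ → ℤ
    σ v = + sℕ v
    R≡ : ∀ c → σ c * g c - σ (suc c) * g (suc c) ≡ R l c
    R≡ c = begin
      σ c * (δ c l - δ c 0) - σ (suc c) * (δ (suc c) l - 0ℤ)
        ≡⟨ expand (σ c) (δ c l) (δ c 0) (σ (suc c)) (δ (suc c) l) ⟩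
      δ c l * σ c - δ c 0 * σ c - δ (suc c) l * σ (suc c)
        ≡⟨ cong₂ (λ a b → a - b - δ (suc c) l * σ (suc c)) (δ-*-subst σ c l) (δ-*-subst σ c 0) ⟩
      δ c l * σ l - δ c 0 * σ 0 - δ (suc c) l * σ (suc c)
        ≡⟨ cong (_-_ (δ c l * σ l - δ c 0 * σ 0)) (δ-*-subst σ (suc c) l) ⟩
      δ c l * σ l - δ c 0 * σ 0 - δ (suc c) l * σ l
        ≡⟨ collect (δ c l) (σ l) (δ c 0) (σ 0) (δ (suc c) l) ⟩
      R l c
        ∎
      where
      open ≡-Reasoning
      expand : ∀ a b c d e → a * (b - c) - d * (e - 0ℤ) ≡ b * a - c * a - e * d
      expand = solve-∀
      collect : ∀ a b c d e → a * b - c * d - e * b ≡ b * (a - e) - d * (c - 0ℤ)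
      collect = solve-∀

  M-maps-image : ∀ z → (Δᵦ · z) ⋆ M ∈Im Δ꜀
  M-maps-image z =
    ∈Im-cong (λ c → sym (pairing (toℕ c) (FP.toℕ<n c))) (∈Im-sumTo k x (λ l c → R l (toℕ c)) R-image)
    where
    Z = extend z
    x : ℕ → ℤ
    x l = Z (vertex l (sℕ l ∸ 1)) - Z 1
    G : ℕ → ℕ × ℕ → ℤ
    G c e = ∂ₑ Z e * ∂ₑ (τ c) e
    pathPairing : ∀ c l → l ℕ.< k → pathSum (offset l) (sℕ l) (G c) ≡ Z 1 * U c l + x l * R l c
    pathPairing c l l<k = begin
      pathSum (offset l) (sℕ l) (G c)
        ≡⟨ sumTo-cong (sℕ l) (λ j → cong₂ (λ a b → (Z (vertex l j) - Z (vertex l (suc j))) * (a - b))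
                                          (potential-vertex (slope c) (Tb c) l l<k j)
                                          (potential-vertex (slope c) (Tb c) l l<k (suc j))) ⟩
      ∑[ j < sℕ l ] (∂ (Z ∘ vertex l) j * ∂ (pathProfile (sℕ l) (slope c l) (Tb c)) j)
        ≡⟨ pathSum-linear (sℕ l) (Z ∘ vertex l) (U c l) (Tb c) (1≤sℕ l l<k) ⟩
      Z (vertex l (sℕ l)) * U c l + (Z (vertex l (sℕ l ∸ 1)) - Z (vertex l (sℕ l))) * R l c - 0ℤ * U c l
        ≡⟨ cong (λ t → Z t * U c l + (Z (vertex l (sℕ l ∸ 1)) - Z t) * R l c - 0ℤ * U c l)
                (vertex-end l l<k) ⟩
      Z 1 * U c l + x l * R l c - 0ℤ * U c l
        ≡⟨ drop (Z 1 * U c l + x l * R l c) (U c l) ⟩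
      Z 1 * U c l + x l * R l c
        ∎
      where
      open ≡-Reasoning
      drop : ∀ a b → a - 0ℤ * b ≡ a
      drop = solve-∀
    pairing : ∀ c → c ℕ.< K → sumℤ (λ i → (Δᵦ · z) i * τ c (suc (toℕ i))) ≡ ∑[ l < k ] (x l * R l c)
    pairing c c<K = begin
      sumℤ (λ i → (Δᵦ · z) i * τ c (suc (toℕ i)))
        ≡⟨ fromEdges-dirichlet (bananaEdges 2 L) proper z (τ c) refl ⟩
      sumList (bananaEdges 2 L) (G c)
        ≡⟨ sumList-bananaEdges 2 L (G c) 1≤L ⟩
      ∑[ l < length L ] pathSum (pathOffset 2 L l) (nth L l) (G c)
        ≡⟨ cong (λ m → ∑[ l < m ] pathSum (offset l) (sℕ l) (G c)) length-L ⟩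
      ∑[ l < k ] pathSum (offset l) (sℕ l) (G c)
        ≡⟨ sumTo-cong< k (pathPairing c) ⟩
      ∑[ l < k ] (Z 1 * U c l + x l * R l c)
        ≡⟨ sumTo-+ k (λ l → Z 1 * U c l) (λ l → x l * R l c) ⟩
      ∑[ l < k ] (Z 1 * U c l) + ∑[ l < k ] (x l * R l c)
        ≡⟨ cong (_+ ∑[ l < k ] (x l * R l c))
                (trans (sumTo-*ˡ k (Z 1) (U c)) (trans (cong (Z 1 *_) (sumTo-U c c<K)) (ℤP.*-zeroʳ (Z 1)))) ⟩
      0ℤ + ∑[ l < k ] (x l * R l c)
        ≡⟨ ℤP.+-identityˡ _ ⟩
      ∑[ l < k ] (x l * R l c)
        ∎
      where open ≡-Reasoning

  V : ℕ → ℕ → ℤ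
  V c w = + sℕ c * δ w (firstVertex c) - δ w 1

  V-image : ∀ c → c ℕ.< k → (λ i → V c (suc (toℕ i))) ∈Im Δᵦ
  V-image c c<k =
    ∈Im-cong (λ i → cong (λ t → + sℕ c * δ (suc (toℕ i)) (firstVertex c) - δ (suc (toℕ i)) t)
                         (vertex-end c c<k))
             (ramp-image c c<k (sℕ c) (1≤sℕ c c<k) ℕP.≤-refl)

  Δ꜀-pairing-φ : ∀ z w → let Z = extend z in
    sumℤ (λ c → (Δ꜀ · z) c * φ (suc (toℕ c)) w)
      ≡ ∑[ c < k ] ((Z (suc c) - Z c) * V c w) + (- (+ sℕ K * (Z k - Z K))) * φ k w
  Δ꜀-pairing-φ z w = begin
    sumℤ (λ c → (Δ꜀ · z) c * φ (suc (toℕ c)) w)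
      ≡⟨ sumℤ-cong (λ c → cong (_* φ (suc (toℕ c)) w) (trans (thickCycle-· z c) (flip (toℕ c)))) ⟩
    sumℤ {K} (λ c → g (toℕ c))
      ≡⟨ sumℤ-sumTo K g ⟩
    sumTo K g
      ≡⟨ sumTo-byParts K D (λ v → φ v w) ⟩
    ∑[ c < K ] (D c * (φ (suc c) w - φ c w)) - D K * φ K w + D 0 * φ 0 w
      ≡⟨ cong₂ (λ a b → a - D K * φ K w + b)
               (sumTo-cong K (λ c → cong (D c *_) (trans (cong (_- φ c w) (sumTo-last c (λ l → δ w (firstVertex l))))
                                                         (cancel (φ c w) (δ w (firstVertex c))))))
               (ℤP.*-zeroʳ (D 0)) ⟩
    ∑[ c < K ] (D c * δ w (firstVertex c)) - D K * φ K w + 0ℤ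
      ≡⟨ addLast (∑[ c < K ] (D c * δ w (firstVertex c))) (D K) (φ K w) (δ w (firstVertex K)) ⟩
    (∑[ c < K ] (D c * δ w (firstVertex c)) + D K * δ w (firstVertex K)) - D K * (φ K w + δ w (firstVertex K))
      ≡⟨ cong₂ (λ a b → a - D K * b) (sym (sumTo-last K (λ c → D c * δ w (firstVertex c))))
                                     (sym (sumTo-last K (λ l → δ w (firstVertex l)))) ⟩
    ∑[ c < k ] (D c * δ w (firstVertex c)) - D K * φ k w
      ≡⟨ cong (_- D K * φ k w)
              (trans (sumTo-cong k (λ c → split (+ sℕ c) (Z (suc c)) (Z c) (δ w (firstVertex c)) (δ w 1)))
                                      (sumTo-+ k (λ c → x c * V c w) (λ c → x c * δ w 1))) ⟩
    ∑[ c < k ] (x c * V c w) + ∑[ c < k ] (x c * δ w 1) - D K * φ k w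
      ≡⟨ cong (λ t → ∑[ c < k ] (x c * V c w) + t - D K * φ k w) closed ⟩
    ∑[ c < k ] (x c * V c w) + 0ℤ - D K * φ k w
      ≡⟨ tidy (∑[ c < k ] (x c * V c w)) (D K) (φ k w) ⟩
    ∑[ c < k ] (x c * V c w) + (- D K) * φ k w
      ∎
    where
    open ≡-Reasoning
    Z = extend z
    D : ℕ → ℤ
    D v = + sℕ v * (Z (suc v) - Z v)
    x : ℕ → ℤ
    x c = Z (suc c) - Z c
    g : ℕ → ℤ
    g c = (D c - D (suc c)) * φ (suc c) w
    -- x sums to Z k - Z 0 = 0 around the cycle
    closed : ∑[ c < k ] (x c * δ w 1) ≡ 0ℤ
    closed = trans (sumTo-*ʳ k (δ w 1) x)
                   (trans (cong (_* δ w 1) (trans (sumTo-telescope′ k Z) (cong (_- 0ℤ) (atℕ-beyond z))))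
                          (ℤP.*-zeroˡ (δ w 1)))
    flip : ∀ c → + sℕ c * (Z (suc c) - Z c) + + sℕ (suc c) * (Z (suc c) - Z (suc (suc c))) ≡ D c - D (suc c)
    flip c = negate (+ sℕ c) (+ sℕ (suc c)) (Z c) (Z (suc c)) (Z (suc (suc c)))
      where
      negate : ∀ sc su zc zu zuu → sc * (zu - zc) + su * (zu - zuu) ≡ sc * (zu - zc) - su * (zuu - zu)
      negate = solve-∀
    cancel : ∀ a b → a + b - a ≡ b
    cancel = solve-∀
    addLast : ∀ s d p i → s - d * p + 0ℤ ≡ (s + d * i) - d * (p + i)
    addLast = solve-∀
    split : ∀ sn zs zc iq i1 → sn * (zs - zc) * iq ≡ (zs - zc) * (sn * iq - i1) + (zs - zc) * i1
    split = solve-∀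
    tidy : ∀ a d p → a + 0ℤ - d * p ≡ a + (- d) * p
    tidy = solve-∀

  N-maps-image : ∀ z → (Δ꜀ · z) ⋆ N ∈Im Δᵦ
  N-maps-image z =
    ∈Im-cong (λ i → sym (Δ꜀-pairing-φ z (suc (toℕ i))))
             (∈Im-+ (∈Im-sumTo k (λ c → Z (suc c) - Z c) (λ c i → V c (suc (toℕ i))) V-image)
                    (∈Im-* (- (+ sℕ K * (Z k - Z K))) firstVertices-image))
    where
    Z = extend z

  direct : ℕ → ℤ
  direct l = boolℤ (sℕ l ≤ᵇ 1)

  -- if path l is a single edge, its first vertex is b
  τ-firstVertex : ∀ c l → l ℕ.< k → τ c (firstVertex l) ≡ U c l - direct l * R l c
  τ-firstVertex c l l<k = trans (potential-vertex (slope c) (Tb c) l l<k 1) (cases (sℕ l ≤ᵇ 1) refl)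
    where
    cases : ∀ b → b ≡ (sℕ l ≤ᵇ 1) → (if b then Tb c else + 1 * U c l) ≡ U c l - boolℤ b * R l c
    cases true b≡ = trans (sym (atB (U c l) (Tb c))) (cong (λ t → U c l - 1ℤ * (+ t * U c l - Tb c)) (sym sℕl≡1))
      where
      sℕl≡1 : sℕ l ≡ 1
      sℕl≡1 = ℕP.≤-antisym (ℕP.≤ᵇ⇒≤ (sℕ l) 1 (subst T b≡ tt)) (1≤sℕ l l<k)
      atB : ∀ u t → u - 1ℤ * (1ℤ * u - t) ≡ t
      atB = solve-∀
    cases false _ = inner (U c l) (R l c)
      where
      inner : ∀ u r → 1ℤ * u ≡ u - 0ℤ * r
      inner = solve-∀

  NM≈I : ∀ c₀ → (λ c → (N c₀ ⋆ M) c - δᶠ c₀ c) ∈Im Δ꜀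
  NM≈I c₀ = ∈Im-cong (λ c → sym (defect (toℕ c)))
                     (∈Im-neg (∈Im-sumTo (suc c0) direct (λ l c → R l (toℕ c))
                                         (λ l l≤c0 → R-image l (l<k l l≤c0))))
    where
    c0 = toℕ c₀
    l<k : ∀ l → l ℕ.< suc c0 → l ℕ.< k
    l<k l l≤c0 = ℕP.≤-trans l≤c0 (ℕP.≤-trans (FP.toℕ<n c₀) (ℕP.n≤1+n K))
    defect : ∀ c → sumℤ {n} (λ i → φ (suc c0) (suc (toℕ i)) * τ c (suc (toℕ i))) - δ c0 c
                     ≡ - ∑[ l < suc c0 ] (direct l * R l c)
    defect c = begin
      sumℤ {n} (λ i → φ (suc c0) (suc (toℕ i)) * τ c (suc (toℕ i))) - δ c0 c
        ≡⟨ cong (_- δ c0 c) (sumℤ-sumTo n (λ v → φ (suc c0) (suc v) * τ c (suc v))) ⟩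
      ∑[ v < n ] (∑[ l < suc c0 ] δ (suc v) (firstVertex l) * τ c (suc v)) - δ c0 c
        ≡⟨ cong (_- δ c0 c)
                (trans (sumTo-cong n (λ v → sym (sumTo-*ʳ (suc c0) (τ c (suc v)) (λ l → δ (suc v) (firstVertex l)))))
                                   (sumTo-swap n (suc c0) (λ v l → δ (suc v) (firstVertex l) * τ c (suc v)))) ⟩
      ∑[ l < suc c0 ] ∑[ v < n ] (δ (suc v) (firstVertex l) * τ c (suc v)) - δ c0 c
        ≡⟨ cong (_- δ c0 c) (sumTo-cong< (suc c0) (λ l l≤c0 →
             trans (sumTo-δ-suc n (firstVertex l) (τ c) refl (vertex-bound l 1 (l<k l l≤c0)))
                   (τ-firstVertex c l (l<k l l≤c0)))) ⟩
      ∑[ l < suc c0 ] (U c l - direct l * R l c) - δ c0 c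
        ≡⟨ cong (_- δ c0 c) (sumTo-sub (suc c0) (U c) (λ l → direct l * R l c)) ⟩
      ∑[ l < suc c0 ] U c l - ∑[ l < suc c0 ] (direct l * R l c) - δ c0 c
        ≡⟨ cong₂ (λ a b → a - ∑[ l < suc c0 ] (direct l * R l c) - b) (sumTo-U-prefix c c0) (δ-sym c0 c) ⟩
      δ c c0 - ∑[ l < suc c0 ] (direct l * R l c) - δ c c0
        ≡⟨ cancel (δ c c0) (∑[ l < suc c0 ] (direct l * R l c)) ⟩
      - ∑[ l < suc c0 ] (direct l * R l c)
        ∎
      where
      open ≡-Reasoning
      cancel : ∀ a b → a - b - a ≡ - b
      cancel = solve-∀

  record Position (v : ℕ) : Set where
    field
      path   : ℕ
      step   : ℕ
      path<  : path ℕ.< k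
      1≤step : 1 ℕ.≤ step
      step≤  : step ℕ.≤ sℕ path
      vertex≡ : vertex path step ≡ v
      τ≡     : ∀ c → τ c v ≡ + step * U c path

  -- b is placed at the end of path 0
  position : ∀ v → 1 ℕ.≤ v → v ℕ.< suc n → Position v
  position (suc zero) _ _ = record
    { path = 0 ; step = sℕ 0 ; path< = ℕ.s≤s ℕ.z≤n ; 1≤step = 1≤sℕ 0 (ℕ.s≤s ℕ.z≤n)
    ; step≤ = ℕP.≤-refl ; vertex≡ = vertex-end 0 (ℕ.s≤s ℕ.z≤n) ; τ≡ = λ _ → refl }
  position (suc (suc v)) _ v< =
    let open OnPath (onPath 2 L 0 (suc (suc v)) (ℕ.s≤s (ℕ.s≤s ℕ.z≤n)) v<)
    in record
    { path = path ; step = step ; path< = subst (path ℕ.<_) length-L path< ; 1≤step = 1≤step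
    ; step≤ = ℕP.<⇒≤ step< ; vertex≡ = vertex≡ ; τ≡ = λ c → potential (slope c) }

  row-pairing : ∀ {v} (p : Position v) w → let open Position p renaming (path to l; step to j) in
    sumℤ {K} (λ c → τ (toℕ c) v * φ (suc (toℕ c)) w) - δ v w
                    ≡ + j * (∑[ c < K ] (δ l c * φ (suc c) w) - φ l w) - δ w (vertex l j)
  row-pairing {v} p w = cong₂ _-_ (begin
    sumℤ {K} (λ c → τ (toℕ c) v * φ (suc (toℕ c)) w)
      ≡⟨ sumℤ-sumTo K (λ c → τ c v * φ (suc c) w) ⟩
    ∑[ c < K ] (τ c v * φ (suc c) w)
      ≡⟨ sumTo-cong K (λ c → trans (cong (_* φ (suc c) w) (τ≡ c)) (expand c)) ⟩
    ∑[ c < K ] (+ j * (δ l c * φ (suc c) w - δ (suc c) l * φ (suc c) w))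
      ≡⟨ sumTo-*ˡ K (+ j) (λ c → δ l c * φ (suc c) w - δ (suc c) l * φ (suc c) w) ⟩
    + j * ∑[ c < K ] (δ l c * φ (suc c) w - δ (suc c) l * φ (suc c) w)
      ≡⟨ cong (+ j *_) (sumTo-sub K (λ c → δ l c * φ (suc c) w) (λ c → δ (suc c) l * φ (suc c) w)) ⟩
    + j * (∑[ c < K ] (δ l c * φ (suc c) w) - ∑[ c < K ] (δ (suc c) l * φ (suc c) w))
      ≡⟨ cong (λ t → + j * (∑[ c < K ] (δ l c * φ (suc c) w) - t)) (sumTo-δ-suc K l (λ c → φ c w) refl path<) ⟩
    + j * (∑[ c < K ] (δ l c * φ (suc c) w) - φ l w)
      ∎)
    (trans (δ-sym v w) (cong (δ w) (sym vertex≡)))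
    where
    open Position p renaming (path to l; step to j)
    open ≡-Reasoning
    expand : ∀ c → + j * U c l * φ (suc c) w ≡ + j * (δ l c * φ (suc c) w - δ (suc c) l * φ (suc c) w)
    expand c = trans (ℤP.*-assoc (+ j) (U c l) (φ (suc c) w))
                     (cong (+ j *_) (trans (*-distribʳ-sub (δ c l) (δ (suc c) l) (φ (suc c) w))
                                           (cong (λ t → t * φ (suc c) w - δ (suc c) l * φ (suc c) w) (δ-sym c l))))

  MN≈I : ∀ i₀ → (λ i → (M i₀ ⋆ N) i - δᶠ i₀ i) ∈Im Δᵦ
  MN≈I i₀ = byCase (l ℕ.<? K)
    where
    v = suc (toℕ i₀)
    pos = position v (ℕ.s≤s ℕ.z≤n) (ℕ.s≤s (FP.toℕ<n i₀))
    open Position pos renaming (path to l; step to j)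
    byCase : Dec (l ℕ.< K) → (λ i → (M i₀ ⋆ N) i - δᶠ i₀ i) ∈Im Δᵦ
    byCase (yes l<K) =
      ∈Im-cong (λ i → sym (trans (row-pairing pos (suc (toℕ i)))
                                 (cong (λ t → + j * t - δ (suc (toℕ i)) (vertex l j)) (telescoped (suc (toℕ i))))))
                                (ramp-image l path< j 1≤step step≤)
      where
      cancel : ∀ a b → a + b - a ≡ b
      cancel = solve-∀
      telescoped : ∀ w → ∑[ c < K ] (δ l c * φ (suc c) w) - φ l w ≡ δ w (firstVertex l)
      telescoped w =
        trans (cong (_- φ l w) (trans (sumTo-δ K l (λ c → φ (suc c) w) l<K)
                                      (sumTo-last l (λ l′ → δ w (firstVertex l′)))))
                           (cancel (φ l w) (δ w (firstVertex l)))
    -- on the last path the term c = l is missing; φ k, the sum over all first vertices, makes up for it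
    byCase (no l≮K) = ∈Im-cong (λ i → sym (trans (row-pairing pos (suc (toℕ i))) (lastPath (suc (toℕ i)))))
                               (∈Im-+ (ramp-image l path< j 1≤step step≤) (∈Im-* (- + j) firstVertices-image))
      where
      l≡K : l ≡ K
      l≡K = ℕP.≤-antisym (ℕP.≤-pred path<) (ℕP.≮⇒≥ l≮K)
      regroup : ∀ j a b d → j * (0ℤ - a) - d ≡ j * b - d + (- j) * (a + b)
      regroup = solve-∀
      lastPath : ∀ w → + j * (∑[ c < K ] (δ l c * φ (suc c) w) - φ l w) - δ w (vertex l j)
                         ≡ + j * δ w (firstVertex l) - δ w (vertex l j) + (- + j) * φ k w
      lastPath w =
        trans (cong (λ t → + j * (t - φ l w) - δ w (vertex l j))
                    (sumTo-δ-beyond K l (λ c → φ (suc c) w) (ℕP.≮⇒≥ l≮K)))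
              (trans (regroup (+ j) (φ l w) (δ w (firstVertex l)) (δ w (vertex l j)))
                     (cong (λ t → + j * δ w (firstVertex l) - δ w (vertex l j) + (- + j) * t)
                           (sym (trans (cong (λ t → φ (suc t) w) (sym l≡K))
                                       (sumTo-last l (λ l′ → δ w (firstVertex l′)))))))

  iso : banana s ≅ₛ thickCycle s
  iso = cokerIso M N M-maps-image N-maps-image NM≈I MN≈I

-- the construction works for every k ≥ 1; 3 ≤ k is only needed to exclude k = 0
corollary3 : (k : ℕ) → 3 ≤ k → (s : Vec ℕ k) → (∀ l → 1 ≤ lookup s l) →
    banana s ≅ₛ thickCycle s
corollary3 zero    ()  s 1≤s
corollary3 (suc K) _   s 1≤s = BananaToCycle.iso K s 1≤s
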